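{- Let $\lambda$ be a fixed positive integer. Then for all sufficiently large $k$, there does not exist a nontrivial $(v,5,k,\lambda)$-SEDF and there does not exist a nontrivial $(v,6,k,\lambda)$-SEDF (for any $v$, in any finite abelian group of order $v$).
   Context: Groups are finite abelian, written multiplicatively with identity $1$. For a subset $A\subseteq G$ we also write $A$ for $\sum_{a\in A}a\in\mathbb{Z}[G]$ and $A^{(-1)}=\sum_{a\in A}a^{ -1}$. Given integers $m\ge 2$, $k\ge1$, $\lambda\ge 1$ and a group $G$ of order $v$, mutually disjoint $k$-subsets $D_1,\dots,D_m$ form a $(v,m,k,\lambda)$-strong external difference family (SEDF) in $G$ if $D_j\sum_{i\ne j}D_i^{(-1)}=\lambda(G-1)$ in $\mathbb{Z}[G]$ for each $j$; it is nontrivial if $k>1$. -}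

module Defs where

open import Data.Nat using (ℕ; zero; suc; _+_)
open import Data.Bool using (if_then_else_)
open import Data.Fin using (Fin; zero; suc; _≟_)
open import Data.Fin.Subset using (Subset; _∈_; _∉_; ∣_∣)
open import Data.Fin.Subset.Properties using (_∈?_)
open import Relation.Nullary using (does; ¬_)
open import Relation.Nullary.Decidable using (_×-dec_)
open import Relation.Binary.PropositionalEquality using (_≡_)
open import Algebra.Structures using (IsAbelianGroup)

Σ : {n : ℕ} → (Fin n → ℕ) → ℕ
Σ {zero}  f = 0
Σ {suc n} f = f zero + Σ (λ i → f (suc i))

-- A finite abelian group of order v, presented (up to isomorphism) with
-- carrier Fin v and propositional equality.
record FinAbGroup (v : ℕ) : Set where
  field
    _∙_ : Fin v → Fin v → Fin v
    ε   : Fin v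
    _⁻¹ : Fin v → Fin v
    isAbelianGroup : IsAbelianGroup _≡_ _∙_ ε _⁻¹

-- Coefficient of g in  D_j * Σ_{i ≠ j} D_i^{(-1)}  in ℤ[G]:
-- number of triples (i, x, y) with i ≠ j, x ∈ D_j, y ∈ D_i, x y⁻¹ = g.
coeffSEDF : {v m : ℕ} → FinAbGroup v → (Fin m → Subset v) → Fin m → Fin v → ℕ
coeffSEDF G D j g =
  Σ (λ i → if does (i ≟ j) then 0 else
    Σ (λ x → Σ (λ y →
      if does ((x ∈? D j) ×-dec ((y ∈? D i) ×-dec ((x ∙ (y ⁻¹)) ≟ g)))
      then 1 else 0)))
  where open FinAbGroup G

record IsSEDF {v : ℕ} (G : FinAbGroup v) (m k lam : ℕ) (D : Fin m → Subset v) : Set where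
  open FinAbGroup G
  field
    m≥2      : 2 Data.Nat.≤ m
    k≥1      : 1 Data.Nat.≤ k
    lam≥1    : 1 Data.Nat.≤ lam
    size     : ∀ i → ∣ D i ∣ ≡ k
    disjoint : ∀ i j → ¬ (i ≡ j) → ∀ x → x ∈ D i → x ∉ D j
    equation : ∀ j g → coeffSEDF G D j g ≡ (if does (g ≟ ε) then 0 else lam)

-- Work in ℤ[G] modulo the ideal ℤG, with D = D₁ + ⋯ + Dₘ, P = D D⁽⁻¹⁾ and L = λ·1.  The SEDF
-- equations say Dⱼ (D − Dⱼ)⁽⁻¹⁾ = −L there, so Aⱼ = Dⱼ D⁽⁻¹⁾ satisfies Aⱼ² = (Aⱼ + L) P and the
-- elements Yⱼ = 2Aⱼ − P are m square roots of Q = P² + 4LP with sum (2 − m) P.  A sum u of m square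
-- roots of q is a root of F_m(u, q) = u^[m even] ∏ (u² − d² q) (d ≡ m mod 2, 0 < d ≤ m), which for
-- m = 5, 6 yields a polynomial relation c L W = 0 between P and L.  The functional τ = ∑ over the
-- nonprincipal characters is nonnegative on every X X⁽⁻¹⁾; an explicit sum-of-squares identity then
-- turns τ W = 0 into τ (L P V) ≤ 0 for a suitable V = aP − bL.  On the other hand, counting gives
-- λ (v − 1) = (m − 1) k², and Cauchy–Schwarz for P − mk together with k ≥ 3λ forces τ (L P V) > 0.

module Submission where

open import Defs
open import Data.Nat using (ℕ)
open import Data.Fin using (Fin)
open import Data.Fin.Subset using (Subset)
import Data.Integer
open import Algebra.Bundles using (CommutativeRing)
open import Algebra.Solver.Ring.AlmostCommutativeRing using (fromCommutativeRing; _-Raw-AlmostCommutative⟶_)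

module Integers where

  open import Data.Nat as ℕ using (ℕ; zero; suc; z≤n; s≤s)
  open import Data.Integer using (ℤ; +_; +[1+_]; -[1+_]; +0; -_; _+_; _*_; _-_; _≤_; _<_; +≤+; +<+)
  import Data.Integer.Properties as ℤ
  open import Data.Fin using (Fin; zero; suc; _≟_)
  open import Data.Fin.Permutation using (permutation)
  open import Data.Bool using (Bool; true; false; if_then_else_)
  open import Relation.Nullary using (does)
  open import Relation.Binary.PropositionalEquality
  open import Function using (_∘_)
  open import Data.Integer.Tactic.RingSolver using (solve-∀)

  open import Algebra.Properties.Semiring.Sum ℤ.+-*-semiring as Sum using (sum)

  -- Opaque, so that unifying ∑ f with ∑ g reduces to unifying f with g.
  opaque
    ∑ : ∀ {n} → (Fin n → ℤ) → ℤ
    ∑ = sum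

  ∑-syntax : ∀ n → (Fin n → ℤ) → ℤ
  ∑-syntax _ = ∑

  infixl 10 ∑-syntax
  syntax ∑-syntax n (λ i → x) = ∑[ i < n ] x

  opaque
    unfolding ∑

    ∑-cong : ∀ {n} {f g : Fin n → ℤ} → (∀ i → f i ≡ g i) → ∑ f ≡ ∑ g
    ∑-cong = Sum.sum-cong-≗

    ∑-distrib-+ : ∀ {n} (f g : Fin n → ℤ) → ∑[ i < n ] (f i + g i) ≡ ∑ f + ∑ g
    ∑-distrib-+ = Sum.∑-distrib-+

    ∑-*ˡ : ∀ {n} c (f : Fin n → ℤ) → ∑[ i < n ] (c * f i) ≡ c * ∑ f
    ∑-*ˡ c f = sym (Sum.*-distribˡ-sum c f)

    ∑-*ʳ : ∀ {n} c (f : Fin n → ℤ) → ∑[ i < n ] (f i * c) ≡ ∑ f * c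
    ∑-*ʳ c f = sym (Sum.*-distribʳ-sum c f)

    ∑-comm : ∀ {m n} (f : Fin m → Fin n → ℤ) → ∑[ i < m ] ∑[ j < n ] f i j ≡ ∑[ j < n ] ∑[ i < m ] f i j
    ∑-comm = Sum.∑-comm

    ∑-bijection : ∀ {n} (f : Fin n → ℤ) (π π⁻¹ : Fin n → Fin n) →
                  (∀ x → π (π⁻¹ x) ≡ x) → (∀ x → π⁻¹ (π x) ≡ x) → ∑ f ≡ ∑ (f ∘ π)
    ∑-bijection f π π⁻¹ inv₁ inv₂ = Sum.∑-permute f (permutation π π⁻¹ inv₁ inv₂)

    ∑-zero : ∀ n → ∑[ i < n ] +0 ≡ +0
    ∑-zero = Sum.sum-replicate-zero

    ∑-neg : ∀ {n} (f : Fin n → ℤ) → ∑[ i < n ] (- f i) ≡ - ∑ f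
    ∑-neg {zero}  f = refl
    ∑-neg {suc n} f = trans (cong (λ s → - f zero + s) (∑-neg (f ∘ suc))) (sym (ℤ.neg-distrib-+ (f zero) _))

    ∑-const : ∀ n c → ∑[ i < n ] c ≡ + n * c
    ∑-const zero    c = sym (ℤ.*-zeroˡ c)
    ∑-const (suc n) c = trans (cong (λ s → c + s) (∑-const n c)) (lemma c (+ n))
      where
      lemma : ∀ c n → c + n * c ≡ (+ 1 + n) * c
      lemma = solve-∀

    ∑-empty : (f : Fin 0 → ℤ) → ∑ f ≡ +0
    ∑-empty f = refl

    ∑-suc : ∀ {n} (f : Fin (suc n) → ℤ) → ∑ f ≡ f zero + ∑ (f ∘ suc)
    ∑-suc f = refl

    ∑-point : ∀ {n} (a : Fin n) (f : Fin n → ℤ) → ∑[ i < n ] (if does (i ≟ a) then f i else +0) ≡ f a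
    ∑-point {suc n} zero    f = trans (cong (λ s → f zero + s) (∑-zero n)) (ℤ.+-identityʳ (f zero))
    ∑-point {suc n} (suc a) f = trans (ℤ.+-identityˡ _) (∑-point a (f ∘ suc))

    ∑-nonneg : ∀ {n} (f : Fin n → ℤ) → (∀ i → +0 ≤ f i) → +0 ≤ ∑ f
    ∑-nonneg {zero}  f _ = +≤+ z≤n
    ∑-nonneg {suc n} f p = ℤ.+-mono-≤ (p zero) (∑-nonneg (f ∘ suc) (p ∘ suc))

    pos-Σ : ∀ {n} (f : Fin n → ℕ) → + Σ f ≡ ∑[ i < n ] (+ f i)
    pos-Σ {zero}  f = refl
    pos-Σ {suc n} f = trans (ℤ.pos-+ (f zero) (Σ (f ∘ suc))) (cong (λ s → + f zero + s) (pos-Σ (f ∘ suc)))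

  ∑-if : ∀ {n} (b : Bool) (f : Fin n → ℤ) →
         ∑[ i < n ] (if b then +0 else f i) ≡ (if b then +0 else ∑ f)
  ∑-if {n} true  f = ∑-zero n
  ∑-if     false f = refl

  ∑-split : ∀ {n} (j : Fin n) (f : Fin n → ℤ) →
            ∑ f ≡ f j + ∑[ i < n ] (if does (i ≟ j) then +0 else f i)
  ∑-split {n} j f = begin
      ∑ f
    ≡⟨ ∑-cong (λ i → split (does (i ≟ j)) (f i)) ⟩
      ∑[ i < n ] ((if does (i ≟ j) then f i else +0) + (if does (i ≟ j) then +0 else f i))
    ≡⟨ ∑-distrib-+ (λ i → if does (i ≟ j) then f i else +0) (λ i → if does (i ≟ j) then +0 else f i) ⟩
      ∑[ i < n ] (if does (i ≟ j) then f i else +0) + ∑[ i < n ] (if does (i ≟ j) then +0 else f i)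
    ≡⟨ cong₂ _+_ (∑-point j f) refl ⟩
      f j + ∑[ i < n ] (if does (i ≟ j) then +0 else f i)
    ∎
    where
    open ≡-Reasoning
    split : ∀ b x → x ≡ (if b then x else +0) + (if b then +0 else x)
    split true  x = sym (ℤ.+-identityʳ x)
    split false x = sym (ℤ.+-identityˡ x)

  ∑-squared-differences : ∀ {n} (z : Fin n → ℤ) →
    ∑[ i < n ] ∑[ j < n ] ((z i - z j) * (z i - z j))
      ≡ + 2 * (+ n * ∑[ i < n ] (z i * z i) - ∑ z * ∑ z)
  ∑-squared-differences {n} z = begin
      ∑[ i < n ] ∑[ j < n ] ((z i - z j) * (z i - z j))
    ≡⟨ ∑-cong (λ i → ∑-cong (λ j → expand (z i) (z j))) ⟩
      ∑[ i < n ] ∑[ j < n ] (z i * z i + (z j * z j + - (+ 2 * z i) * z j))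
    ≡⟨ ∑-cong (λ i → trans (∑-distrib-+ (λ _ → z i * z i) (λ j → z j * z j + - (+ 2 * z i) * z j))
          (cong₂ _+_ (∑-const n (z i * z i))
            (trans (∑-distrib-+ (λ j → z j * z j) (λ j → - (+ 2 * z i) * z j))
              (cong (λ s → S₂ + s) (∑-*ˡ (- (+ 2 * z i)) z))))) ⟩
      ∑[ i < n ] (+ n * (z i * z i) + (S₂ + - (+ 2 * z i) * S₁))
    ≡⟨ ∑-cong (λ i → swap (+ n) (z i) S₂ S₁) ⟩
      ∑[ i < n ] (+ n * (z i * z i) + (S₂ + - (+ 2 * S₁) * z i))
    ≡⟨ trans (∑-distrib-+ (λ i → + n * (z i * z i)) (λ i → S₂ + - (+ 2 * S₁) * z i))
          (cong₂ _+_ (∑-*ˡ (+ n) (λ i → z i * z i))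
            (trans (∑-distrib-+ (λ _ → S₂) (λ i → - (+ 2 * S₁) * z i))
              (cong₂ _+_ (∑-const n S₂) (∑-*ˡ (- (+ 2 * S₁)) z)))) ⟩
      + n * S₂ + (+ n * S₂ + - (+ 2 * S₁) * S₁)
    ≡⟨ collect (+ n) S₂ S₁ ⟩
      + 2 * (+ n * S₂ - S₁ * S₁)
    ∎
    where
    open ≡-Reasoning
    S₁ = ∑ z
    S₂ = ∑[ i < n ] (z i * z i)
    expand : ∀ a b → (a - b) * (a - b) ≡ a * a + (b * b + - (+ 2 * a) * b)
    expand = solve-∀
    swap : ∀ n a s₂ s₁ → n * (a * a) + (s₂ + - (+ 2 * a) * s₁) ≡ n * (a * a) + (s₂ + - (+ 2 * s₁) * a)
    swap = solve-∀
    collect : ∀ n s₂ s₁ → n * s₂ + (n * s₂ + - (+ 2 * s₁) * s₁) ≡ + 2 * (n * s₂ - s₁ * s₁)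
    collect = solve-∀

  *-pos : ∀ {a b} → +0 < a → +0 < b → +0 < a * b
  *-pos {+[1+ m ]} {+[1+ n ]} _        _        = +<+ (s≤s z≤n)
  *-pos {+0}                   (+<+ ()) _
  *-pos {+[1+ m ]} {+0}        _        (+<+ ())
  *-pos { -[1+ m ]}            ()       _
  *-pos {+[1+ m ]} { -[1+ n ]} _        ()

  *-nonneg : ∀ {a b} → +0 ≤ a → +0 ≤ b → +0 ≤ a * b
  *-nonneg {+ m} {+ n} _ _ = subst (+0 ≤_) (ℤ.pos-* m n) (+≤+ z≤n)

  n≥1⇒+n>0 : ∀ {n} → 1 ℕ.≤ n → +0 < + n
  n≥1⇒+n>0 {suc n} _ = +<+ (s≤s z≤n)

  a*x≡0⇒x≡0 : ∀ {a} x → +0 < a → a * x ≡ +0 → x ≡ +0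
  a*x≡0⇒x≡0 {+[1+ n ]} x _ e = ℤ.*-cancelˡ-≡ +[1+ n ] x +0 (trans e (sym (ℤ.*-zeroʳ +[1+ n ])))
  a*x≡0⇒x≡0 {+0}       x (+<+ ())

  square-nonneg : ∀ a → +0 ≤ a * a
  square-nonneg (+ n)    = subst (+0 ≤_) (ℤ.pos-* n n) (+≤+ z≤n)
  square-nonneg -[1+ n ] = +≤+ z≤n

  cauchy-schwarz : ∀ {n} (z : Fin n → ℤ) → +0 ≤ + n * ∑[ i < n ] (z i * z i) - ∑ z * ∑ z
  cauchy-schwarz z = ℤ.*-cancelˡ-≤-pos +0 _ (+ 2)
    (subst (+0 ≤_) (∑-squared-differences z)
      (∑-nonneg _ (λ i → ∑-nonneg _ (λ j → square-nonneg (z i - z j)))))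

-- Written over an arbitrary ring signature so that one definition serves both the ring
-- and the solver's syntax.  # n is the integer n.
module RingExpressions {a} {A : Set a} (_⊞_ _⊠_ _⊟_ : A → A → A) (# : ℕ → A) where

  open import Data.Nat as ℕ using (zero; suc; _<_; s≤s)

  F : ℕ → A → A → A
  F zero          u q = u
  F (suc zero)    u q = (u ⊠ u) ⊟ (# 1 ⊠ q)
  F (suc (suc n)) u q = F n u q ⊠ ((u ⊠ u) ⊟ (# (suc (suc n) ℕ.* suc (suc n)) ⊠ q))

  -- Obtained by dividing F (2 + n) (y + u) q − F (1 + n) u q · (u + (3 + n) y) by y² − q.
  cofactor : ∀ n → n < 5 → A → A → A → A
  cofactor 0 _ u y q = y ⊞ (# 3 ⊠ u)
  cofactor 1 _ u y q = (((y ⊠ y) ⊞ (# 4 ⊠ (u ⊠ y))) ⊞ (# 6 ⊠ (u ⊠ u))) ⊟ (# 9 ⊠ q)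
  cofactor 2 _ u y q =
    ((((y ⊠ y) ⊠ y) ⊞ (# 5 ⊠ ((u ⊠ y) ⊠ y))) ⊞ ((# 10 ⊠ ((u ⊠ u) ⊠ y)) ⊞ (# 10 ⊠ ((u ⊠ u) ⊠ u))))
    ⊟ ((# 19 ⊠ (y ⊠ q)) ⊞ (# 55 ⊠ (u ⊠ q)))
  cofactor 3 _ u y q =
    (((((y ⊠ y) ⊠ (y ⊠ y)) ⊞ (# 6 ⊠ (u ⊠ ((y ⊠ y) ⊠ y))))
        ⊞ ((# 15 ⊠ ((u ⊠ u) ⊠ (y ⊠ y))) ⊞ (# 20 ⊠ (((u ⊠ u) ⊠ u) ⊠ y))))
      ⊞ ((# 15 ⊠ ((u ⊠ u) ⊠ (u ⊠ u))) ⊞ (# 225 ⊠ (q ⊠ q))))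
    ⊟ (((# 34 ⊠ ((y ⊠ y) ⊠ q)) ⊞ (# 134 ⊠ ((u ⊠ y) ⊠ q))) ⊞ (# 195 ⊠ ((u ⊠ u) ⊠ q)))
  cofactor 4 _ u y q =
    (((((((y ⊠ y) ⊠ (y ⊠ y)) ⊠ y) ⊞ (# 7 ⊠ (u ⊠ ((y ⊠ y) ⊠ (y ⊠ y)))))
          ⊞ ((# 21 ⊠ ((u ⊠ u) ⊠ ((y ⊠ y) ⊠ y))) ⊞ (# 35 ⊠ (((u ⊠ u) ⊠ u) ⊠ (y ⊠ y)))))
        ⊞ ((# 35 ⊠ (((u ⊠ u) ⊠ (u ⊠ u)) ⊠ y)) ⊞ (# 21 ⊠ (((u ⊠ u) ⊠ (u ⊠ u)) ⊠ u))))
      ⊞ ((# 729 ⊠ (y ⊠ (q ⊠ q))) ⊞ (# 2079 ⊠ (u ⊠ (q ⊠ q)))))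
    ⊟ (((# 55 ⊠ (((y ⊠ y) ⊠ y) ⊠ q)) ⊞ (# 273 ⊠ ((u ⊠ (y ⊠ y)) ⊠ q)))
        ⊞ ((# 539 ⊠ (((u ⊠ u) ⊠ y) ⊠ q)) ⊞ (# 525 ⊠ (((u ⊠ u) ⊠ u) ⊠ q))))
  cofactor (suc (suc (suc (suc (suc n))))) (s≤s (s≤s (s≤s (s≤s (s≤s ()))))) u y q


module SquareRootSums {c ℓ} (R : CommutativeRing c ℓ)
       (ι-hom : Data.Integer.+-*-rawRing -Raw-AlmostCommutative⟶ fromCommutativeRing R) where

  open import Data.Nat as ℕ using (ℕ; zero; suc; _<_; s≤s)
  open import Data.Nat.Properties using (m≤n⇒m≤1+n)
  open import Data.Integer as ℤ using (ℤ; +_)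
  open import Data.Fin using (Fin; zero; suc)
  open import Function using (_∘_)
  open import Data.Maybe using (Maybe; just; nothing)
  open import Relation.Nullary using (yes; no)
  import Relation.Binary.PropositionalEquality as ≡
  import Algebra.Solver.Ring
  import Algebra.Properties.Monoid.Sum as MonoidSum

  open CommutativeRing R hiding (zero)
  open _-Raw-AlmostCommutative⟶_ ι-hom renaming (⟦_⟧ to ι)
  open import Relation.Binary.Reasoning.Setoid setoid
  open MonoidSum +-monoid using (sum)

  coefficient≟ : ∀ a b → Maybe (ι a ≈ ι b)
  coefficient≟ a b with a ℤ.≟ b
  ... | yes ≡.refl = just refl
  ... | no  _    = nothing

  open Algebra.Solver.Ring ℤ.+-*-rawRing (fromCommutativeRing R) ι-hom coefficient≟ public

  open RingExpressions _+_ _*_ _-_ (λ n → ι (+ n)) public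
  module Syntax {m} = RingExpressions {A = Polynomial m} _:+_ _:*_ _:-_ (λ n → con (+ n))

  F-cong : ∀ n {u u′ q} → u ≈ u′ → F n u q ≈ F n u′ q
  F-cong zero          p = p
  F-cong (suc zero)    p = +-cong (*-cong p p) refl
  F-cong (suc (suc n)) p = *-cong (F-cong n p) (+-cong (*-cong p p) refl)

  F-step : ∀ n (n<5 : n < 5) u y q →
           F (2 ℕ.+ n) (y + u) q ≈ F (1 ℕ.+ n) u q * (u + ι (+ (3 ℕ.+ n)) * y)
                                   + (y * y - q) * cofactor n n<5 u y q
  F-step 0 p = solve 3 (λ u y q → Syntax.F 2 (y :+ u) q
                                := Syntax.F 1 u q :* (u :+ con (+ 3) :* y) :+ (y :* y :- q) :* Syntax.cofactor 0 p u y q) refl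
  F-step 1 p = solve 3 (λ u y q → Syntax.F 3 (y :+ u) q
                                := Syntax.F 2 u q :* (u :+ con (+ 4) :* y) :+ (y :* y :- q) :* Syntax.cofactor 1 p u y q) refl
  F-step 2 p = solve 3 (λ u y q → Syntax.F 4 (y :+ u) q
                                := Syntax.F 3 u q :* (u :+ con (+ 5) :* y) :+ (y :* y :- q) :* Syntax.cofactor 2 p u y q) refl
  F-step 3 p = solve 3 (λ u y q → Syntax.F 5 (y :+ u) q
                                := Syntax.F 4 u q :* (u :+ con (+ 6) :* y) :+ (y :* y :- q) :* Syntax.cofactor 3 p u y q) refl
  F-step 4 p = solve 3 (λ u y q → Syntax.F 6 (y :+ u) q
                                := Syntax.F 5 u q :* (u :+ con (+ 7) :* y) :+ (y :* y :- q) :* Syntax.cofactor 4 p u y q) refl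
  F-step (suc (suc (suc (suc (suc n))))) (s≤s (s≤s (s≤s (s≤s (s≤s ())))))

  sum-of-square-roots : ∀ n → n < 6 → ∀ {q} (y : Fin (suc n) → Carrier) →
                        (∀ i → y i * y i ≈ q) → F (suc n) (sum y) q ≈ 0#
  sum-of-square-roots zero _ {q} y square = begin
      (y zero + 0#) * (y zero + 0#) - ι (+ 1) * q  ≈⟨ F-cong 1 (+-identityʳ (y zero)) ⟩
      y zero * y zero - ι (+ 1) * q                ≈⟨ +-cong (square zero) refl ⟩
      q - ι (+ 1) * q                              ≈⟨ solve 1 (λ q → q :- con (+ 1) :* q := con (+ 0)) refl q ⟩
      ι (+ 0)                                      ≈⟨ 0-homo ⟩
      0#                                           ∎
  sum-of-square-roots (suc n) (s≤s n<5) {q} y square = begin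
      F (2 ℕ.+ n) (y zero + s) q
    ≈⟨ F-step n n<5 s (y zero) q ⟩
      F (1 ℕ.+ n) s q * _ + (y zero * y zero - q) * _
    ≈⟨ +-cong (*-cong (sum-of-square-roots n (m≤n⇒m≤1+n n<5) (y ∘ suc) (square ∘ suc)) refl)
              (*-cong (trans (+-cong (square zero) refl) (-‿inverseʳ q)) refl) ⟩
      0# * _ + 0# * _
    ≈⟨ trans (+-cong (zeroˡ _) (zeroˡ _)) (+-identityˡ 0#) ⟩
      0#
    ∎
    where s = sum (y ∘ suc)

module GroupRing {v : ℕ} (G : FinAbGroup v) where

  open import Data.Nat as ℕ using (ℕ; zero; suc; z≤n)
  open import Data.Integer as ℤ using (ℤ; +_; +0; -_; _+_; _*_; _-_; _≤_; _<_; +≤+)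
  import Data.Integer.Properties as ℤ
  open import Data.Fin as Fin using (Fin; _≟_)
  open import Data.Bool using (true; false; if_then_else_)
  open import Data.Product using (_,_)
  open import Relation.Nullary using (does; yes; no)
  open import Data.Empty using (⊥-elim)
  open import Relation.Binary.PropositionalEquality
  open import Relation.Binary.Structures using (IsEquivalence)
  open import Algebra.Bundles using (AbelianGroup; CommutativeRing)
  open import Algebra.Structures using (IsAbelianGroup; IsGroup)
  open import Data.Integer.Tactic.RingSolver using (solve-∀)
  open import Function using (_∘_)
  import Algebra.Properties.Semiring.Sum
  open Integers

  open FinAbGroup G
  open IsAbelianGroup isAbelianGroup using (assoc; comm; identityˡ)

  private
    abelianGroup : AbelianGroup _ _
    abelianGroup = record { isAbelianGroup = isAbelianGroup }

  open IsGroup (IsAbelianGroup.isGroup isAbelianGroup) public using (_\\_)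

  open import Algebra.Properties.AbelianGroup abelianGroup
    using (\\-leftDividesˡ; \\-leftDividesʳ; ⁻¹-involutive; ε⁻¹≈ε; ⁻¹-anti-homo-∙; ⁻¹-∙-comm)
  open import Algebra.Properties.AbelianGroup abelianGroup public using (⁻¹-anti-homo-\\)

  \\-involutive : ∀ h g → (h \\ g) \\ g ≡ h
  \\-involutive h g = begin
      ((h \\ g) ⁻¹) ∙ g  ≡⟨ cong (_∙ g) (⁻¹-anti-homo-\\ h g) ⟩
      (g \\ h) ∙ g     ≡⟨ comm (g \\ h) g ⟩
      g ∙ (g \\ h)     ≡⟨ \\-leftDividesˡ g h ⟩
      h                ∎
    where open ≡-Reasoning

  ∙-\\ : ∀ k h g → (k ∙ h) \\ g ≡ h \\ (k \\ g)
  ∙-\\ k h g = trans (cong (_∙ g) (⁻¹-anti-homo-∙ k h)) (assoc (h ⁻¹) (k ⁻¹) g)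

  ε-\\ : ∀ g → ε \\ g ≡ g
  ε-\\ g = trans (cong (_∙ g) ε⁻¹≈ε) (identityˡ g)

  ⁻¹≟ε : ∀ g → does (g ⁻¹ ≟ ε) ≡ does (g ≟ ε)
  ⁻¹≟ε g with g ⁻¹ ≟ ε | g ≟ ε
  ... | yes _ | yes _ = refl
  ... | no  _ | no  _ = refl
  ... | yes p | no ¬q = ⊥-elim (¬q (trans (sym (⁻¹-involutive g)) (trans (cong _⁻¹ p) ε⁻¹≈ε)))
  ... | no ¬p | yes q = ⊥-elim (¬p (trans (cong _⁻¹ q) ε⁻¹≈ε))

  ∙⁻¹≟⇔≟\\ : ∀ x y g → does (x ∙ (y ⁻¹) ≟ g) ≡ does (y ≟ g \\ x)
  ∙⁻¹≟⇔≟\\ x y g with x ∙ (y ⁻¹) ≟ g | y ≟ g \\ x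
  ... | yes _ | yes _ = refl
  ... | no  _ | no  _ = refl
  ... | yes p | no ¬q = ⊥-elim (¬q (trans (sym (\\-involutive y x)) (cong (_\\ x) (trans (comm (y ⁻¹) x) p))))
  ... | no ¬p | yes q = ⊥-elim (¬p (trans (comm x (y ⁻¹)) (trans (cong (_\\ x) q) (\\-involutive g x))))

  ℤ[G] : Set
  ℤ[G] = Fin v → ℤ

  infixl 7 _⋆_
  infixl 6 _⊕_

  opaque
    _⋆_ : ℤ[G] → ℤ[G] → ℤ[G]
    (X ⋆ Y) g = ∑[ h < v ] (X h * Y (h \\ g))

    _⊕_ : ℤ[G] → ℤ[G] → ℤ[G]
    (X ⊕ Y) g = X g + Y g

    ⊝ : ℤ[G] → ℤ[G]
    ⊝ X g = - X g

    ι : ℤ → ℤ[G]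
    ι c g = if does (g ≟ ε) then c else +0

    conj : ℤ[G] → ℤ[G]
    conj X g = X (g ⁻¹)

  0ᴳ : ℤ[G]
  0ᴳ _ = +0

  ∑-left-translate : ∀ (Y : ℤ[G]) h → ∑[ g < v ] Y (h \\ g) ≡ ∑ Y
  ∑-left-translate Y h = sym (∑-bijection Y (h \\_) (h ∙_) (\\-leftDividesʳ h) (\\-leftDividesˡ h))

  ∑-\\ : ∀ (Y : ℤ[G]) g → ∑[ h < v ] Y (h \\ g) ≡ ∑ Y
  ∑-\\ Y g = sym (∑-bijection Y (_\\ g) (_\\ g) (λ h → \\-involutive h g) (λ h → \\-involutive h g))

  ∑-⁻¹ : ∀ (Y : ℤ[G]) → ∑[ g < v ] Y (g ⁻¹) ≡ ∑ Y
  ∑-⁻¹ Y = sym (∑-bijection Y _⁻¹ _⁻¹ ⁻¹-involutive ⁻¹-involutive)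

  opaque
    unfolding _⋆_ _⊕_ ⊝ ι conj

    ⋆-comm : ∀ X Y → X ⋆ Y ≗ Y ⋆ X
    ⋆-comm X Y g = trans (∑-bijection _ (_\\ g) (_\\ g) (λ h → \\-involutive h g) (λ h → \\-involutive h g))
      (∑-cong λ h → trans (cong (λ x → X (h \\ g) * Y x) (\\-involutive h g)) (ℤ.*-comm (X (h \\ g)) (Y h)))

    ⋆-assoc : ∀ X Y Z → (X ⋆ Y) ⋆ Z ≗ X ⋆ (Y ⋆ Z)
    ⋆-assoc X Y Z g = begin
        ∑[ h < v ] (∑[ k < v ] (X k * Y (k \\ h)) * Z (h \\ g))
      ≡⟨ ∑-cong (λ h → sym (∑-*ʳ (Z (h \\ g)) (λ k → X k * Y (k \\ h)))) ⟩
        ∑[ h < v ] ∑[ k < v ] (X k * Y (k \\ h) * Z (h \\ g))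
      ≡⟨ ∑-comm (λ h k → X k * Y (k \\ h) * Z (h \\ g)) ⟩
        ∑[ k < v ] ∑[ h < v ] (X k * Y (k \\ h) * Z (h \\ g))
      ≡⟨ ∑-cong (λ k → trans (∑-cong (λ h → ℤ.*-assoc (X k) _ _)) (∑-*ˡ (X k) _)) ⟩
        ∑[ k < v ] (X k * ∑[ h < v ] (Y (k \\ h) * Z (h \\ g)))
      ≡⟨ ∑-cong (λ k → cong (X k *_) (translate k)) ⟩
        ∑[ k < v ] (X k * (Y ⋆ Z) (k \\ g))
      ∎
      where
      open ≡-Reasoning
      translate : ∀ k → ∑[ h < v ] (Y (k \\ h) * Z (h \\ g)) ≡ (Y ⋆ Z) (k \\ g)
      translate k = trans (∑-bijection _ (k ∙_) (k \\_) (\\-leftDividesˡ k) (\\-leftDividesʳ k))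
        (∑-cong (λ h → cong₂ _*_ (cong Y (\\-leftDividesʳ k h)) (cong Z (∙-\\ k h g))))

    ⋆-distribˡ : ∀ X Y Z → X ⋆ (Y ⊕ Z) ≗ X ⋆ Y ⊕ X ⋆ Z
    ⋆-distribˡ X Y Z g = trans (∑-cong (λ h → ℤ.*-distribˡ-+ (X h) _ _))
      (∑-distrib-+ (λ h → X h * Y (h \\ g)) (λ h → X h * Z (h \\ g)))

    ⋆-distribʳ : ∀ X Y Z → (Y ⊕ Z) ⋆ X ≗ Y ⋆ X ⊕ Z ⋆ X
    ⋆-distribʳ X Y Z g = trans (⋆-comm (Y ⊕ Z) X g)
      (trans (⋆-distribˡ X Y Z g) (cong₂ _+_ (⋆-comm X Y g) (⋆-comm X Z g)))

    ι-⋆ : ∀ c X → ι c ⋆ X ≗ λ g → c * X g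
    ι-⋆ c X g = trans (∑-cong point) (trans (∑-point ε (λ h → c * X (h \\ g))) (cong (λ x → c * X x) (ε-\\ g)))
      where
      point : ∀ h → ι c h * X (h \\ g) ≡ (if does (h ≟ ε) then c * X (h \\ g) else +0)
      point h with does (h ≟ ε)
      ... | true  = refl
      ... | false = refl

    conj-⋆ : ∀ X Y → conj (X ⋆ Y) ≗ conj X ⋆ conj Y
    conj-⋆ X Y g = trans (sym (∑-⁻¹ _))
      (∑-cong (λ h → cong (λ x → X (h ⁻¹) * Y x) (⁻¹-∙-comm (h ⁻¹) g)))

    ∑-⋆ : ∀ X Y → ∑ (X ⋆ Y) ≡ ∑ X * ∑ Y
    ∑-⋆ X Y = trans (∑-comm (λ g h → X h * Y (h \\ g)))
      (trans (∑-cong (λ h → trans (∑-*ˡ (X h) (λ g → Y (h \\ g))) (cong (X h *_) (∑-left-translate Y h))))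
        (∑-*ʳ (∑ Y) X))

    ⊕-at : ∀ X Y g → (X ⊕ Y) g ≡ X g + Y g
    ⊕-at X Y g = refl

    ⋆-at : ∀ X Y g → (X ⋆ Y) g ≡ ∑[ h < v ] (X h * Y (h \\ g))
    ⋆-at X Y g = refl

    conj-at : ∀ X g → conj X g ≡ X (g ⁻¹)
    conj-at X g = refl

    ι-at : ∀ c g → ι c g ≡ (if does (g ≟ ε) then c else +0)
    ι-at c g = refl

    ⊕-comm : ∀ X Y → X ⊕ Y ≗ Y ⊕ X
    ⊕-comm X Y g = ℤ.+-comm (X g) (Y g)

    ⊕-assoc : ∀ X Y Z → X ⊕ Y ⊕ Z ≗ X ⊕ (Y ⊕ Z)
    ⊕-assoc X Y Z g = ℤ.+-assoc (X g) (Y g) (Z g)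

    ⊕-identityˡ : ∀ X → 0ᴳ ⊕ X ≗ X
    ⊕-identityˡ X g = ℤ.+-identityˡ (X g)

    ⊕-inverseˡ : ∀ X → ⊝ X ⊕ X ≗ 0ᴳ
    ⊕-inverseˡ X g = ℤ.+-inverseˡ (X g)

    ι-+ : ∀ a b → ι (a + b) ≗ ι a ⊕ ι b
    ι-+ a b g with does (g ≟ ε)
    ... | true  = refl
    ... | false = refl

    ι-neg : ∀ a → ι (- a) ≗ ⊝ (ι a)
    ι-neg a g with does (g ≟ ε)
    ... | true  = refl
    ... | false = refl

    ι-0 : ι +0 ≗ 0ᴳ
    ι-0 g with does (g ≟ ε)
    ... | true  = refl
    ... | false = refl

    ι-* : ∀ a b → ι (a * b) ≗ ι a ⋆ ι b
    ι-* a b g = sym (trans (ι-⋆ a (ι b) g) (lemma (does (g ≟ ε))))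
      where
      lemma : ∀ t → a * (if t then b else +0) ≡ (if t then a * b else +0)
      lemma true  = refl
      lemma false = ℤ.*-zeroʳ a

    ι-ε : ∀ c → ι c ε ≡ c
    ι-ε c with ε ≟ ε
    ... | yes _ = refl
    ... | no ¬p = ⊥-elim (¬p refl)

    ∑-ι : ∀ c → ∑ (ι c) ≡ c
    ∑-ι c = ∑-point ε (λ _ → c)

    conj-ι : ∀ c → conj (ι c) ≗ ι c
    conj-ι c g = cong (λ t → if t then c else +0) (⁻¹≟ε g)

    conj-involutive : ∀ X → conj (conj X) ≗ X
    conj-involutive X g = cong X (⁻¹-involutive g)

    conj-⊕ : ∀ X Y → conj (X ⊕ Y) ≗ conj X ⊕ conj Y
    conj-⊕ X Y g = refl

    conj-⊝ : ∀ X → conj (⊝ X) ≗ ⊝ (conj X)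
    conj-⊝ X g = refl

    ∑-conj : ∀ X → ∑ (conj X) ≡ ∑ X
    ∑-conj = ∑-⁻¹

    ⋆-conj-at-ε : ∀ X → (X ⋆ conj X) ε ≡ ∑[ g < v ] (X g * X g)
    ⋆-conj-at-ε X = ∑-cong (λ h → cong (λ x → X h * X x) (trans (⁻¹-anti-homo-\\ h ε) (ε-\\ h)))

  -- ℤ[G] modulo the ideal ℤG of multiples of G = ∑_g g: there the SEDF equations become
  -- exact identities, and the trace τ below is well defined.
  infix 4 _≈_
  record _≈_ (X Y : ℤ[G]) : Set where
    constructor differ-by
    field
      offset    : ℤ
      pointwise : ∀ g → X g ≡ Y g + offset

  ≗⇒≈ : ∀ {X Y} → X ≗ Y → X ≈ Y
  ≗⇒≈ e = differ-by +0 λ g → trans (e g) (sym (ℤ.+-identityʳ _))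

  ≈-refl : ∀ {X} → X ≈ X
  ≈-refl = ≗⇒≈ (λ g → refl)

  ≈-sym : ∀ {X Y} → X ≈ Y → Y ≈ X
  ≈-sym {X} {Y} (differ-by c e) = differ-by (- c) λ g → lemma (X g) (Y g) c (e g)
    where
    lemma : ∀ x y c → x ≡ y + c → y ≡ x + - c
    lemma _ y c refl = shift y c
      where
      shift : ∀ y c → y ≡ y + c + - c
      shift = solve-∀

  ≈-trans : ∀ {X Y Z} → X ≈ Y → Y ≈ Z → X ≈ Z
  ≈-trans {Z = Z} (differ-by c e) (differ-by d f) = differ-by (d + c) λ g →
    trans (e g) (trans (cong (_+ c) (f g)) (ℤ.+-assoc (Z g) d c))

  ≈-isEquivalence : IsEquivalence _≈_
  ≈-isEquivalence = record { refl = ≈-refl ; sym = ≈-sym ; trans = ≈-trans }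

  opaque
    unfolding _⋆_ _⊕_ ⊝ conj

    ⊕-cong : ∀ {X X′ Y Y′} → X ≈ X′ → Y ≈ Y′ → X ⊕ Y ≈ X′ ⊕ Y′
    ⊕-cong {X′ = X′} {Y′ = Y′} (differ-by c e) (differ-by d f) = differ-by (c + d) λ g →
      trans (cong₂ _+_ (e g) (f g)) (interchange (X′ g) c (Y′ g) d)
      where
      interchange : ∀ a c b d → (a + c) + (b + d) ≡ (a + b) + (c + d)
      interchange = solve-∀

    ⊝-cong : ∀ {X X′} → X ≈ X′ → ⊝ X ≈ ⊝ X′
    ⊝-cong {X′ = X′} (differ-by c e) = differ-by (- c) λ g → trans (cong -_ (e g)) (ℤ.neg-distrib-+ (X′ g) c)

    ⋆-congʳ : ∀ {X X′} Y → X ≈ X′ → X ⋆ Y ≈ X′ ⋆ Y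
    ⋆-congʳ {X′ = X′} Y (differ-by c e) = differ-by (c * ∑ Y) λ g →
      trans (∑-cong (λ h → trans (cong (_* Y (h \\ g)) (e h)) (ℤ.*-distribʳ-+ (Y (h \\ g)) (X′ h) c)))
        (trans (∑-distrib-+ (λ h → X′ h * Y (h \\ g)) (λ h → c * Y (h \\ g)))
          (cong (λ s → (X′ ⋆ Y) g + s) (trans (∑-*ˡ c (λ h → Y (h \\ g))) (cong (c *_) (∑-\\ Y g)))))

    conj-cong : ∀ {X Y} → X ≈ Y → conj X ≈ conj Y
    conj-cong (differ-by c e) = differ-by c λ g → e (g ⁻¹)

  ⋆-cong : ∀ {X X′ Y Y′} → X ≈ X′ → Y ≈ Y′ → X ⋆ Y ≈ X′ ⋆ Y′
  ⋆-cong {X} {X′} {Y} {Y′} p q = ≈-trans (⋆-congʳ Y p)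
    (≈-trans (≗⇒≈ (⋆-comm X′ Y)) (≈-trans (⋆-congʳ X′ q) (≗⇒≈ (⋆-comm Y′ X′))))

  ⋆-identityˡ : ∀ X → ι (+ 1) ⋆ X ≗ X
  ⋆-identityˡ X g = trans (ι-⋆ (+ 1) X g) (ℤ.*-identityˡ (X g))

  quotientRing : CommutativeRing _ _
  quotientRing = record
    { Carrier = ℤ[G] ; _≈_ = _≈_ ; _+_ = _⊕_ ; _*_ = _⋆_ ; -_ = ⊝ ; 0# = 0ᴳ ; 1# = ι (+ 1)
    ; isCommutativeRing = record
      { isRing = record
        { +-isAbelianGroup = record
          { isGroup = record
            { isMonoid = record
              { isSemigroup = record
                { isMagma = record { isEquivalence = ≈-isEquivalence ; ∙-cong = ⊕-cong }
                ; assoc = λ X Y Z → ≗⇒≈ (⊕-assoc X Y Z) }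
              ; identity = (λ X → ≗⇒≈ (⊕-identityˡ X))
                         , (λ X → ≗⇒≈ (λ g → trans (⊕-comm X 0ᴳ g) (⊕-identityˡ X g))) }
            ; inverse = (λ X → ≗⇒≈ (⊕-inverseˡ X))
                      , (λ X → ≗⇒≈ (λ g → trans (⊕-comm X (⊝ X) g) (⊕-inverseˡ X g)))
            ; ⁻¹-cong = ⊝-cong }
          ; comm = λ X Y → ≗⇒≈ (⊕-comm X Y) }
        ; *-cong = ⋆-cong
        ; *-assoc = λ X Y Z → ≗⇒≈ (⋆-assoc X Y Z)
        ; *-identity = (λ X → ≗⇒≈ (⋆-identityˡ X))
                     , (λ X → ≗⇒≈ (λ g → trans (⋆-comm X (ι (+ 1)) g) (⋆-identityˡ X g)))
        ; distrib = (λ X Y Z → ≗⇒≈ (⋆-distribˡ X Y Z)) , (λ X Y Z → ≗⇒≈ (⋆-distribʳ X Y Z))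
        }
      ; *-comm = λ X Y → ≗⇒≈ (⋆-comm X Y)
      }
    }

  ι-homomorphism : ℤ.+-*-rawRing -Raw-AlmostCommutative⟶ fromCommutativeRing quotientRing
  ι-homomorphism = record
    { ⟦_⟧    = ι
    ; +-homo = λ a b → ≗⇒≈ (ι-+ a b)
    ; *-homo = λ a b → ≗⇒≈ (ι-* a b)
    ; -‿homo = λ a → ≗⇒≈ (ι-neg a)
    ; 0-homo = ≗⇒≈ ι-0
    ; 1-homo = ≈-refl
    }

  open SquareRootSums quotientRing ι-homomorphism public
    using (solve; _:=_; con; _:+_; _:*_; _:-_; :-_; module Syntax; F; F-cong; sum-of-square-roots)

  infixl 6 _⊖_
  _⊖_ : ℤ[G] → ℤ[G] → ℤ[G]
  X ⊖ Y = X ⊕ ⊝ Y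

  SelfConjugate : ℤ[G] → Set
  SelfConjugate X = conj X ≈ X

  ι-selfConjugate : ∀ c → SelfConjugate (ι c)
  ι-selfConjugate c = ≗⇒≈ (conj-ι c)

  ⊖-selfConjugate : ∀ {X Y} → SelfConjugate X → SelfConjugate Y → SelfConjugate (X ⊖ Y)
  ⊖-selfConjugate {X} {Y} p q = ≈-trans (≗⇒≈ (conj-⊕ X (⊝ Y))) (⊕-cong p (≈-trans (≗⇒≈ (conj-⊝ Y)) (⊝-cong q)))

  ⋆-selfConjugate : ∀ {X Y} → SelfConjugate X → SelfConjugate Y → SelfConjugate (X ⋆ Y)
  ⋆-selfConjugate {X} {Y} p q = ≈-trans (≗⇒≈ (conj-⋆ X Y)) (⋆-cong p q)

  norm-selfConjugate : ∀ X → SelfConjugate (X ⋆ conj X)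
  norm-selfConjugate X =
    ≈-trans (≗⇒≈ (conj-⋆ X (conj X))) (≈-trans (⋆-cong ≈-refl (≗⇒≈ (conj-involutive X))) (≗⇒≈ (⋆-comm (conj X) X)))

  private module QuotientSum = Algebra.Properties.Semiring.Sum (CommutativeRing.semiring quotientRing)
  open QuotientSum public using (sum)

  opaque
    unfolding _⊕_

    sum-at : ∀ {m} (X : Fin m → ℤ[G]) g → sum X g ≡ ∑[ i < m ] X i g
    sum-at {zero}  X g = sym (∑-empty _)
    sum-at {suc m} X g = trans (cong (λ s → X Fin.zero g + s) (sum-at (X ∘ Fin.suc) g)) (sym (∑-suc (λ i → X i g)))

  sum-⋆ʳ : ∀ {m} (X : Fin m → ℤ[G]) Y → sum (λ i → X i ⋆ Y) ≈ sum X ⋆ Y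
  sum-⋆ʳ X Y = ≈-sym (QuotientSum.*-distribʳ-sum Y X)

  sum-⋆ˡ : ∀ {m} Y (X : Fin m → ℤ[G]) → sum (λ i → Y ⋆ X i) ≈ Y ⋆ sum X
  sum-⋆ˡ Y X = ≈-sym (QuotientSum.*-distribˡ-sum Y X)

  sum-⊖ : ∀ {m} (X : Fin m → ℤ[G]) Y → sum (λ i → X i ⊖ Y) ≈ sum X ⊖ ι (+ m) ⋆ Y
  sum-⊖ {zero} X Y = ≈-trans (≈-sym (≗⇒≈ ι-0))
    (≈-trans (solve 1 (λ y → con +0 := con +0 :- con +0 :* y) ≈-refl Y) (⊕-cong (≗⇒≈ ι-0) ≈-refl))
  sum-⊖ {suc m} X Y = ≈-trans (⊕-cong ≈-refl (sum-⊖ (X ∘ Fin.suc) Y))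
    (≈-trans (solve 4 (λ x s y n → x :- y :+ (s :- n :* y) := x :+ s :- (con (+ 1) :+ n) :* y) ≈-refl
                      (X Fin.zero) (sum (X ∘ Fin.suc)) Y (ι (+ m)))
      (⊕-cong ≈-refl (⊝-cong (⋆-cong (≈-sym (≗⇒≈ (ι-+ (+ 1) (+ m)))) ≈-refl))))

  -- τ X = ∑_{χ ≠ 1} χ(X), the sum of X over the nonprincipal characters, written without
  -- characters by orthogonality.  It vanishes on ℤG, and τ (X ⋆ conj X) = ∑_{χ ≠ 1} |χ(X)|² ≥ 0.
  opaque
    τ : ℤ[G] → ℤ
    τ X = + v * X ε - ∑ X

  opaque
    unfolding τ _⋆_ _⊕_ ⊝ ι

    τ-cong : ∀ {X Y} → X ≈ Y → τ X ≡ τ Y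
    τ-cong {X} {Y} (differ-by c e) = begin
        + v * X ε - ∑ X
      ≡⟨ cong₂ (λ a b → + v * a - b) (e ε) (trans (∑-cong e) (trans (∑-distrib-+ Y (λ _ → c)) (cong (λ s → ∑ Y + s) (∑-const v c)))) ⟩
        + v * (Y ε + c) - (∑ Y + + v * c)
      ≡⟨ cancel (+ v) (Y ε) c (∑ Y) ⟩
        + v * Y ε - ∑ Y
      ∎
      where
      open ≡-Reasoning
      cancel : ∀ n a c s → n * (a + c) - (s + n * c) ≡ n * a - s
      cancel = solve-∀

    τ-⊕ : ∀ X Y → τ (X ⊕ Y) ≡ τ X + τ Y
    τ-⊕ X Y = trans (cong (λ s → + v * (X ε + Y ε) - s) (∑-distrib-+ X Y)) (regroup (+ v) (X ε) (Y ε) (∑ X) (∑ Y))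
      where
      regroup : ∀ n a b s t → n * (a + b) - (s + t) ≡ (n * a - s) + (n * b - t)
      regroup = solve-∀

    τ-⊝ : ∀ X → τ (⊝ X) ≡ - τ X
    τ-⊝ X = trans (cong (λ s → + v * (- X ε) - s) (∑-neg X)) (regroup (+ v) (X ε) (∑ X))
      where
      regroup : ∀ n a s → n * (- a) - (- s) ≡ - (n * a - s)
      regroup = solve-∀

    τ-ι⋆ : ∀ c X → τ (ι c ⋆ X) ≡ c * τ X
    τ-ι⋆ c X = trans (cong₂ (λ a s → + v * a - s) (ι-⋆ c X ε) (trans (∑-cong (ι-⋆ c X)) (∑-*ˡ c X)))
      (regroup (+ v) c (X ε) (∑ X))
      where
      regroup : ∀ n c a s → n * (c * a) - c * s ≡ c * (n * a - s)
      regroup = solve-∀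

    τ-ι : ∀ c → τ (ι c) ≡ (+ v - + 1) * c
    τ-ι c = trans (cong₂ (λ a b → + v * a - b) (ι-ε c) (∑-ι c)) (regroup (+ v) c)
      where
      regroup : ∀ n c → n * c - c ≡ (n - + 1) * c
      regroup = solve-∀

    τ-norm : ∀ X → τ (X ⋆ conj X) ≡ + v * ∑[ g < v ] (X g * X g) - ∑ X * ∑ X
    τ-norm X = cong₂ (λ a b → + v * a - b) (⋆-conj-at-ε X) (trans (∑-⋆ X (conj X)) (cong (∑ X *_) (∑-conj X)))

  τ-0 : τ 0ᴳ ≡ +0
  τ-0 = trans (τ-cong (≈-sym (≗⇒≈ ι-0))) (trans (τ-ι +0) (ℤ.*-zeroʳ (+ v - + 1)))

  τ-norm-nonneg : ∀ X → +0 ≤ τ (X ⋆ conj X)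
  τ-norm-nonneg X = subst (+0 ≤_) (sym (τ-norm X)) (cauchy-schwarz X)

  τ-square-nonneg : ∀ {Z} → SelfConjugate Z → +0 ≤ τ (Z ⋆ Z)
  τ-square-nonneg {Z} self = subst (+0 ≤_) (τ-cong (⋆-cong ≈-refl self)) (τ-norm-nonneg Z)

  τ-norm⋆square-nonneg : ∀ X {Z} → SelfConjugate Z → +0 ≤ τ (X ⋆ conj X ⋆ (Z ⋆ Z))
  τ-norm⋆square-nonneg X {Z} self = subst (+0 ≤_) (τ-cong regroup) (τ-norm-nonneg (X ⋆ Z))
    where
    regroup : (X ⋆ Z) ⋆ conj (X ⋆ Z) ≈ X ⋆ conj X ⋆ (Z ⋆ Z)
    regroup = ≈-trans (⋆-cong ≈-refl (≈-trans (≗⇒≈ (conj-⋆ X Z)) (⋆-cong ≈-refl self)))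
      (solve 3 (λ x x̄ z → (x :* z) :* (x̄ :* z) := x :* x̄ :* (z :* z)) ≈-refl X (conj X) Z)

  τ-⊕-nonneg : ∀ {X Y} → +0 ≤ τ X → +0 ≤ τ Y → +0 ≤ τ (X ⊕ Y)
  τ-⊕-nonneg {X} {Y} p q = subst (+0 ≤_) (sym (τ-⊕ X Y)) (ℤ.+-mono-≤ p q)

  τ-ι⋆-nonneg : ∀ n {X} → +0 ≤ τ X → +0 ≤ τ (ι (+ n) ⋆ X)
  τ-ι⋆-nonneg n {X} p = subst (+0 ≤_) (sym (τ-ι⋆ (+ n) X)) (*-nonneg {+ n} (+≤+ z≤n) p)

  τ-ι⋆-pos : ∀ {n} → 1 ℕ.≤ n → ∀ {X} → +0 < τ X → +0 < τ (ι (+ n) ⋆ X)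
  τ-ι⋆-pos n≥1 {X} p = subst (+0 <_) (sym (τ-ι⋆ _ X)) (*-pos (n≥1⇒+n>0 n≥1) p)

  τ-sum : ∀ {m} (X : Fin m → ℤ[G]) → τ (sum X) ≡ ∑[ i < m ] τ (X i)
  τ-sum {zero}  X = trans τ-0 (sym (∑-empty _))
  τ-sum {suc m} X = trans (τ-⊕ (X Fin.zero) _) (trans (cong (λ s → τ (X Fin.zero) + s) (τ-sum (X ∘ Fin.suc))) (sym (∑-suc _)))

  τ-centred-square : ∀ X c → τ ((X ⊖ ι c) ⋆ (X ⊖ ι c)) ≡ τ (X ⋆ X) - + 2 * c * τ X + (+ v - + 1) * (c * c)
  τ-centred-square X c = begin
      τ ((X ⊖ ι c) ⋆ (X ⊖ ι c))
    ≡⟨ τ-cong expand ⟩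
      τ (X ⋆ X ⊖ ι (+ 2 * c) ⋆ X ⊕ ι (c * c))
    ≡⟨ trans (τ-⊕ _ _) (cong₂ _+_ (trans (τ-⊕ _ _) (cong (λ s → τ (X ⋆ X) + s) (trans (τ-⊝ _) (cong -_ (τ-ι⋆ (+ 2 * c) X))))) (τ-ι (c * c))) ⟩
      τ (X ⋆ X) - + 2 * c * τ X + (+ v - + 1) * (c * c)
    ∎
    where
    open ≡-Reasoning
    expand : (X ⊖ ι c) ⋆ (X ⊖ ι c) ≈ X ⋆ X ⊖ ι (+ 2 * c) ⋆ X ⊕ ι (c * c)
    expand = ≈-trans (solve 2 (λ x i → (x :- i) :* (x :- i) := x :* x :- con (+ 2) :* i :* x :+ i :* i) ≈-refl X (ι c))
      (⊕-cong (⊕-cong ≈-refl (⊝-cong (⋆-cong (≈-sym (≗⇒≈ (ι-* (+ 2) c))) ≈-refl))) (≈-sym (≗⇒≈ (ι-* c c))))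

module Arithmetic where

  open import Data.Nat as ℕ using (suc; z≤n; s≤s)
  open import Data.Nat.Properties using (m≤n⇒∃[o]m+o≡n)
  open import Data.Integer as ℤ using (ℤ; +_; +0; _+_; _*_; _-_; _≤_; _<_; +≤+; +<+)
  import Data.Integer.Properties as ℤ
  open import Data.Product using (_,_)
  open import Relation.Binary.PropositionalEquality
  open import Data.Integer.Tactic.RingSolver using (solve-∀)
  open Integers using (*-nonneg)

  infixl 6 _⊞_
  infixl 7 _⊠_
  data Poly : Set where
    #_    : ℕ → Poly
    𝑥 𝑦   : Poly
    _⊞_ _⊠_ : Poly → Poly → Poly

  ⟦_⟧ : Poly → ℤ → ℤ → ℤ
  ⟦ # c ⟧   x y = + c
  ⟦ 𝑥 ⟧     x y = x
  ⟦ 𝑦 ⟧     x y = y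
  ⟦ p ⊞ q ⟧ x y = ⟦ p ⟧ x y + ⟦ q ⟧ x y
  ⟦ p ⊠ q ⟧ x y = ⟦ p ⟧ x y * ⟦ q ⟧ x y

  ⟦⟧-nonneg : ∀ p (x y : ℕ) → +0 ≤ ⟦ p ⟧ (+ x) (+ y)
  ⟦⟧-nonneg (# c)   x y = +≤+ z≤n
  ⟦⟧-nonneg 𝑥       x y = +≤+ z≤n
  ⟦⟧-nonneg 𝑦       x y = +≤+ z≤n
  ⟦⟧-nonneg (p ⊞ q) x y = ℤ.+-mono-≤ (⟦⟧-nonneg p x y) (⟦⟧-nonneg q x y)
  ⟦⟧-nonneg (p ⊠ q) x y = *-nonneg (⟦⟧-nonneg p x y) (⟦⟧-nonneg q x y)

  -- What remains of λ (a t₂ − b λ t₁) − a λ d, where t₁ = τ P, t₂ = τ P² and d = τ (P − mk)²,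
  -- once v is eliminated through λ (v − 1) = (m − 1) k².
  Φ : ℤ → ℤ → ℤ → ℤ → ℤ → ℤ
  Φ m a b k l = m * ((m - + 1) * k * k * k - m * l * k * k + l * k) * (+ 2 * a * m * k - b * l) - a * (m - + 1) * m * m * k * k * k * k

  elimination : ∀ m a b l k V t₂ →
    l * (a * t₂ - b * l * (m * (V * k - k * k - (V - + 1) * l)))
      ≡ a * l * (t₂ - + 2 * (m * k) * (m * (V * k - k * k - (V - + 1) * l)) + (V - + 1) * ((m * k) * (m * k)))
        + (m * ((m - + 1) * k * k * k - m * l * k * k + l * k) * (+ 2 * a * m * k - b * l) - a * (m - + 1) * m * m * k * k * k * k)
        + (l * (V - + 1) - (m - + 1) * (k * k)) * (m * (k - l) * (+ 2 * a * m * k - b * l) - a * m * m * k * k)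
  elimination = solve-∀

  trace-positivity : ∀ m a b (lam k : ℕ) (V t₂ : ℤ) →
    let t₁ = m * (V * + k - + k * + k - (V - + 1) * + lam) in
    +0 ≤ a → + lam * (V - + 1) ≡ (m - + 1) * (+ k * + k) →
    +0 ≤ t₂ - + 2 * (m * + k) * t₁ + (V - + 1) * ((m * + k) * (m * + k)) →
    +0 < Φ m a b (+ k) (+ lam) →
    +0 < + lam * (a * t₂ - b * + lam * t₁)
  trace-positivity m a b lam k V t₂ a≥0 relation d≥0 Φ>0 =
    subst (+0 <_) (sym identity) (ℤ.+-mono-≤-< (*-nonneg (*-nonneg a≥0 (+≤+ z≤n)) d≥0) Φ>0)
    where
    l = + lam
    t₁ = m * (V * + k - + k * + k - (V - + 1) * l)
    d = t₂ - + 2 * (m * + k) * t₁ + (V - + 1) * ((m * + k) * (m * + k))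
    M = m * (+ k - l) * (+ 2 * a * m * + k - b * l) - a * m * m * + k * + k
    identity : l * (a * t₂ - b * l * t₁) ≡ a * l * d + Φ m a b (+ k) l
    identity = begin
        l * (a * t₂ - b * l * t₁)
      ≡⟨ elimination m a b l (+ k) V t₂ ⟩
        a * l * d + Φ m a b (+ k) l + (l * (V - + 1) - (m - + 1) * (+ k * + k)) * M
      ≡⟨ cong (λ e → a * l * d + Φ m a b (+ k) l + e * M) (ℤ.i≡j⇒i-j≡0 relation) ⟩
        a * l * d + Φ m a b (+ k) l + +0 * M
      ≡⟨ ℤ.+-identityʳ _ ⟩
        a * l * d + Φ m a b (+ k) l
      ∎
      where open ≡-Reasoning

  k-form : ∀ l t → + (3 ℕ.* suc l ℕ.+ t) ≡ + 3 + + 3 * + l + + t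
  k-form l t = trans (ℤ.pos-+ (3 ℕ.* suc l) t) (cong (_+ + t) (trans (ℤ.pos-* 3 (suc l)) (trans (cong (+ 3 *_) (ℤ.pos-+ 1 l)) (distribute (+ l)))))
    where
    distribute : ∀ l → + 3 * (+ 1 + l) ≡ + 3 + + 3 * l
    distribute = solve-∀

  -- With λ = 1 + l and k = 3λ + t, Φ becomes a constant plus a polynomial in l, t with natural coefficients.
  R₅ R₆ : Poly
  R₅ = # 8305 ⊠ 𝑦 ⊞ # 6245 ⊠ 𝑦 ⊠ 𝑦 ⊞ # 1880 ⊠ 𝑦 ⊠ 𝑦 ⊠ 𝑦 ⊞ # 200 ⊠ 𝑦 ⊠ 𝑦 ⊠ 𝑦 ⊠ 𝑦 ⊞ # 12195 ⊠ 𝑥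
       ⊞ # 24320 ⊠ 𝑥 ⊠ 𝑦 ⊞ # 12390 ⊠ 𝑥 ⊠ 𝑦 ⊠ 𝑦 ⊞ # 1880 ⊠ 𝑥 ⊠ 𝑦 ⊠ 𝑦 ⊠ 𝑦 ⊞ # 16965 ⊠ 𝑥 ⊠ 𝑥 ⊞ # 23725 ⊠ 𝑥 ⊠ 𝑥 ⊠ 𝑦
       ⊞ # 6145 ⊠ 𝑥 ⊠ 𝑥 ⊠ 𝑦 ⊠ 𝑦 ⊞ # 10425 ⊠ 𝑥 ⊠ 𝑥 ⊠ 𝑥 ⊞ # 7710 ⊠ 𝑥 ⊠ 𝑥 ⊠ 𝑥 ⊠ 𝑦 ⊞ # 2385 ⊠ 𝑥 ⊠ 𝑥 ⊠ 𝑥 ⊠ 𝑥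
  R₆ = # 22224 ⊠ 𝑦 ⊞ # 16776 ⊠ 𝑦 ⊠ 𝑦 ⊞ # 5064 ⊠ 𝑦 ⊠ 𝑦 ⊠ 𝑦 ⊞ # 540 ⊠ 𝑦 ⊠ 𝑦 ⊠ 𝑦 ⊠ 𝑦 ⊞ # 32832 ⊠ 𝑥
       ⊞ # 65400 ⊠ 𝑥 ⊠ 𝑦 ⊞ # 33336 ⊠ 𝑥 ⊠ 𝑦 ⊠ 𝑦 ⊞ # 5064 ⊠ 𝑥 ⊠ 𝑦 ⊠ 𝑦 ⊠ 𝑦 ⊞ # 46440 ⊠ 𝑥 ⊠ 𝑥 ⊞ # 64128 ⊠ 𝑥 ⊠ 𝑥 ⊠ 𝑦
       ⊞ # 16560 ⊠ 𝑥 ⊠ 𝑥 ⊠ 𝑦 ⊠ 𝑦 ⊞ # 29088 ⊠ 𝑥 ⊠ 𝑥 ⊠ 𝑥 ⊞ # 20952 ⊠ 𝑥 ⊠ 𝑥 ⊠ 𝑥 ⊠ 𝑦 ⊞ # 6804 ⊠ 𝑥 ⊠ 𝑥 ⊠ 𝑥 ⊠ 𝑥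

  Φ₅-expansion : ∀ l t →
      + 5 * ((+ 5 - + 1) * (+ 3 + + 3 * l + t) * (+ 3 + + 3 * l + t) * (+ 3 + + 3 * l + t)
               - + 5 * (+ 1 + l) * (+ 3 + + 3 * l + t) * (+ 3 + + 3 * l + t) + (+ 1 + l) * (+ 3 + + 3 * l + t))
        * (+ 2 * + 2 * + 5 * (+ 3 + + 3 * l + t) - + 1 * (+ 1 + l))
      - + 2 * (+ 5 - + 1) * + 5 * + 5 * (+ 3 + + 3 * l + t) * (+ 3 + + 3 * l + t) * (+ 3 + + 3 * l + t) * (+ 3 + + 3 * l + t)
      ≡ + 3270 + (+ 8305 * t + + 6245 * t * t + + 1880 * t * t * t + + 200 * t * t * t * t + + 12195 * l
           + + 24320 * l * t + + 12390 * l * t * t + + 1880 * l * t * t * t + + 16965 * l * l + + 23725 * l * l * t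
           + + 6145 * l * l * t * t + + 10425 * l * l * l + + 7710 * l * l * l * t + + 2385 * l * l * l * l)
  Φ₅-expansion = solve-∀

  Φ₆-expansion : ∀ l t →
      + 6 * ((+ 6 - + 1) * (+ 3 + + 3 * l + t) * (+ 3 + + 3 * l + t) * (+ 3 + + 3 * l + t)
               - + 6 * (+ 1 + l) * (+ 3 + + 3 * l + t) * (+ 3 + + 3 * l + t) + (+ 1 + l) * (+ 3 + + 3 * l + t))
        * (+ 2 * + 3 * + 6 * (+ 3 + + 3 * l + t) - + 4 * (+ 1 + l))
      - + 3 * (+ 6 - + 1) * + 6 * + 6 * (+ 3 + + 3 * l + t) * (+ 3 + + 3 * l + t) * (+ 3 + + 3 * l + t) * (+ 3 + + 3 * l + t)
      ≡ + 8676 + (+ 22224 * t + + 16776 * t * t + + 5064 * t * t * t + + 540 * t * t * t * t + + 32832 * l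
           + + 65400 * l * t + + 33336 * l * t * t + + 5064 * l * t * t * t + + 46440 * l * l + + 64128 * l * l * t
           + + 16560 * l * l * t * t + + 29088 * l * l * l + + 20952 * l * l * l * t + + 6804 * l * l * l * l)
  Φ₆-expansion = solve-∀

  Φ₅-positive : ∀ {lam k} → 1 ℕ.≤ lam → 3 ℕ.* lam ℕ.≤ k → +0 < Φ (+ 5) (+ 2) (+ 1) (+ k) (+ lam)
  Φ₅-positive {suc l} _ 3λ≤k with m≤n⇒∃[o]m+o≡n 3λ≤k
  ... | t , refl = subst (+0 <_) (sym (trans (cong₂ (Φ (+ 5) (+ 2) (+ 1)) (k-form l t) (ℤ.pos-+ 1 l)) (Φ₅-expansion (+ l) (+ t))))
                     (ℤ.+-mono-<-≤ (+<+ (s≤s z≤n)) (⟦⟧-nonneg R₅ l t))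

  Φ₆-positive : ∀ {lam k} → 1 ℕ.≤ lam → 3 ℕ.* lam ℕ.≤ k → +0 < Φ (+ 6) (+ 3) (+ 4) (+ k) (+ lam)
  Φ₆-positive {suc l} _ 3λ≤k with m≤n⇒∃[o]m+o≡n 3λ≤k
  ... | t , refl = subst (+0 <_) (sym (trans (cong₂ (Φ (+ 6) (+ 3) (+ 4)) (k-form l t) (ℤ.pos-+ 1 l)) (Φ₆-expansion (+ l) (+ t))))
                     (ℤ.+-mono-<-≤ (+<+ (s≤s z≤n)) (⟦⟧-nonneg R₆ l t))

module SEDF {v : ℕ} (G : FinAbGroup v) {m k lam : ℕ} (D : Fin m → Subset v) (sedf : IsSEDF G m k lam D) where

  open import Data.Nat as ℕ using (zero; suc; z≤n; s≤s)
  open import Data.Integer as ℤ using (ℤ; +_; +0; -_; _+_; _*_; _-_; _≤_; _<_)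
  open import Data.Empty using (⊥)
  open Arithmetic using (Φ; trace-positivity)
  import Data.Integer.Properties as ℤ
  open import Data.Nat.Properties using (≤-trans)
  open import Data.Fin using (Fin; zero; suc; _≟_; fromℕ<)
  open import Data.Fin.Subset using (Subset; ∣_∣)
  open import Data.Fin.Subset.Properties using (_∈?_)
  open import Data.Vec using (_∷_; [])
  open import Data.Bool using (Bool; true; false; if_then_else_; _∧_)
  open import Relation.Nullary using (does)
  open import Relation.Nullary.Decidable using (_×-dec_)
  open import Relation.Binary.PropositionalEquality
  open import Data.Integer.Tactic.RingSolver using (solve-∀)
  open Integers
  open GroupRing G
  open FinAbGroup G using (_∙_; _⁻¹; ε)
  open IsSEDF sedf using (m≥2; size; equation; lam≥1)

  𝟙 : Subset v → ℤ[G]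
  𝟙 A g = if does (g ∈? A) then + 1 else +0

  ∑-𝟙 : ∀ {n} (A : Subset n) → ∑[ g < n ] (if does (g ∈? A) then + 1 else +0) ≡ + ∣ A ∣
  ∑-𝟙 []          = ∑-empty _
  ∑-𝟙 (true ∷ A)  = trans (∑-suc _) (trans (cong (λ s → + 1 + s) (∑-𝟙 A)) (sym (ℤ.pos-+ 1 ∣ A ∣)))
  ∑-𝟙 (false ∷ A) = trans (∑-suc _) (trans (ℤ.+-identityˡ _) (∑-𝟙 A))

  𝟙-idempotent : ∀ A g → 𝟙 A g * 𝟙 A g ≡ 𝟙 A g
  𝟙-idempotent A g with does (g ∈? A)
  ... | true  = refl
  ... | false = refl

  Dᵢ : Fin m → ℤ[G]
  Dᵢ i = 𝟙 (D i)

  ∑-Dᵢ : ∀ i → ∑ (Dᵢ i) ≡ + k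
  ∑-Dᵢ i = trans (∑-𝟙 (D i)) (cong +_ (size i))

  others : Fin m → ℤ[G]
  others j g = ∑[ i < m ] (if does (i ≟ j) then +0 else Dᵢ i g)

  S : ℤ[G]
  S = sum Dᵢ

  S-split : ∀ j → S ≈ Dᵢ j ⊕ others j
  S-split j = ≗⇒≈ λ g → trans (sum-at Dᵢ g) (trans (∑-split j (λ i → Dᵢ i g)) (sym (⊕-at (Dᵢ j) (others j) g)))

  private
    indicator-∧ : ∀ a b c → + (if a ∧ (b ∧ c) then 1 else 0) ≡ (if a then + 1 else +0) * (if c then (if b then + 1 else +0) else +0)
    indicator-∧ true  true  true  = refl
    indicator-∧ true  true  false = refl
    indicator-∧ true  false true  = refl
    indicator-∧ true  false false = refl
    indicator-∧ false b     c     = refl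

    *-if : ∀ a (b : Bool) w → a * (if b then +0 else w) ≡ (if b then +0 else a * w)
    *-if a true  w = ℤ.*-zeroʳ a
    *-if a false w = refl

  pairs-with-quotient : ∀ j i g x →
    ∑[ y < v ] (+ (if does ((x ∈? D j) ×-dec ((y ∈? D i) ×-dec ((x ∙ (y ⁻¹)) ≟ g))) then 1 else 0))
      ≡ Dᵢ j x * Dᵢ i (g \\ x)
  pairs-with-quotient j i g x =
    trans (∑-cong (λ y → trans (indicator-∧ (does (x ∈? D j)) (does (y ∈? D i)) (does ((x ∙ (y ⁻¹)) ≟ g)))
                               (cong (λ c → Dᵢ j x * (if c then Dᵢ i y else +0)) (∙⁻¹≟⇔≟\\ x y g))))
      (trans (∑-*ˡ (Dᵢ j x) (λ y → if does (y ≟ g \\ x) then Dᵢ i y else +0))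
        (cong (Dᵢ j x *_) (∑-point (g \\ x) (Dᵢ i))))

  coeffSEDF≡⋆conj : ∀ j g → + coeffSEDF G D j g ≡ (Dᵢ j ⋆ conj (others j)) g
  coeffSEDF≡⋆conj j g = begin
      + coeffSEDF G D j g
    ≡⟨ pos-Σ _ ⟩
      ∑[ i < m ] (+ (if does (i ≟ j) then 0 else Σ (λ x → Σ (λ y → if does ((x ∈? D j) ×-dec ((y ∈? D i) ×-dec ((x ∙ (y ⁻¹)) ≟ g))) then 1 else 0))))
    ≡⟨ ∑-cong (λ i → trans (pos-if (does (i ≟ j)))
         (cong (λ w → if does (i ≟ j) then +0 else w) (trans (pos-Σ _) (∑-cong (λ x → trans (pos-Σ _) (pairs-with-quotient j i g x)))))) ⟩
      ∑[ i < m ] (if does (i ≟ j) then +0 else ∑[ x < v ] (Dᵢ j x * Dᵢ i (g \\ x)))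
    ≡⟨ ∑-cong (λ i → sym (∑-if (does (i ≟ j)) (λ x → Dᵢ j x * Dᵢ i (g \\ x)))) ⟩
      ∑[ i < m ] ∑[ x < v ] (if does (i ≟ j) then +0 else Dᵢ j x * Dᵢ i (g \\ x))
    ≡⟨ ∑-comm (λ i x → if does (i ≟ j) then +0 else Dᵢ j x * Dᵢ i (g \\ x)) ⟩
      ∑[ x < v ] ∑[ i < m ] (if does (i ≟ j) then +0 else Dᵢ j x * Dᵢ i (g \\ x))
    ≡⟨ ∑-cong (λ x → trans (∑-cong (λ i → sym (*-if (Dᵢ j x) (does (i ≟ j)) _))) (∑-*ˡ (Dᵢ j x) _)) ⟩
      ∑[ x < v ] (Dᵢ j x * others j (g \\ x))
    ≡⟨ ∑-cong (λ x → cong (Dᵢ j x *_) (sym (trans (conj-at (others j) (x \\ g)) (cong (others j) (⁻¹-anti-homo-\\ x g))))) ⟩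
      ∑[ x < v ] (Dᵢ j x * conj (others j) (x \\ g))
    ≡⟨ sym (⋆-at (Dᵢ j) (conj (others j)) g) ⟩
      (Dᵢ j ⋆ conj (others j)) g
    ∎
    where
    open ≡-Reasoning
    pos-if : ∀ b {n} → + (if b then 0 else n) ≡ (if b then +0 else + n)
    pos-if true  = refl
    pos-if false = refl

  L : ℤ[G]
  L = ι (+ lam)

  sedf-equation-at : ∀ j g → (Dᵢ j ⋆ conj (others j)) g ≡ ι (- + lam) g + + lam
  sedf-equation-at j g = begin
      (Dᵢ j ⋆ conj (others j)) g                          ≡⟨ sym (coeffSEDF≡⋆conj j g) ⟩
      + coeffSEDF G D j g                                 ≡⟨ cong +_ (equation j g) ⟩
      + (if does (g ≟ ε) then 0 else lam)                 ≡⟨ shift (does (g ≟ ε)) ⟩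
      (if does (g ≟ ε) then - + lam else +0) + + lam      ≡⟨ cong (_+ + lam) (sym (ι-at (- + lam) g)) ⟩
      ι (- + lam) g + + lam                               ∎
    where
    open ≡-Reasoning
    shift : ∀ b → + (if b then 0 else lam) ≡ (if b then - + lam else +0) + + lam
    shift true  = sym (ℤ.+-inverseˡ (+ lam))
    shift false = sym (ℤ.+-identityˡ (+ lam))

  sedf-equation : ∀ j → Dᵢ j ⋆ conj (others j) ≈ ⊝ L
  sedf-equation j = ≈-trans (differ-by (+ lam) (sedf-equation-at j)) (≗⇒≈ (ι-neg (+ lam)))

  ∑-others : ∀ j → ∑ (others j) ≡ (+ m - + 1) * + k
  ∑-others j = begin
      ∑[ g < v ] ∑[ i < m ] (if does (i ≟ j) then +0 else Dᵢ i g)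
    ≡⟨ ∑-comm (λ g i → if does (i ≟ j) then +0 else Dᵢ i g) ⟩
      ∑[ i < m ] ∑[ g < v ] (if does (i ≟ j) then +0 else Dᵢ i g)
    ≡⟨ ∑-cong (λ i → trans (∑-if (does (i ≟ j)) (Dᵢ i)) (cong (λ w → if does (i ≟ j) then +0 else w) (∑-Dᵢ i))) ⟩
      ∑[ i < m ] (if does (i ≟ j) then +0 else + k)
    ≡⟨ remove-one (+ m) (+ k) _ (trans (sym (∑-const m (+ k))) (∑-split j (λ _ → + k))) ⟩
      (+ m - + 1) * + k
    ∎
    where
    open ≡-Reasoning
    remove-one : ∀ m k s → m * k ≡ k + s → s ≡ (m - + 1) * k
    remove-one m k s e = trans (sym (cancel k s)) (trans (cong (_- k) (sym e)) (factor m k))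
      where
      cancel : ∀ k s → (k + s) - k ≡ s
      cancel = solve-∀
      factor : ∀ m k → m * k - k ≡ (m - + 1) * k
      factor = solve-∀

  parameter-relation : + lam * (+ v - + 1) ≡ (+ m - + 1) * (+ k * + k)
  parameter-relation = begin
      + lam * (+ v - + 1)
    ≡⟨ expand (+ lam) (+ v) ⟩
      - + lam + + v * + lam
    ≡⟨ cong₂ _+_ (sym (∑-ι (- + lam))) (sym (∑-const v (+ lam))) ⟩
      ∑ (ι (- + lam)) + ∑[ g < v ] (+ lam)
    ≡⟨ sym (∑-distrib-+ (ι (- + lam)) (λ _ → + lam)) ⟩
      ∑[ g < v ] (ι (- + lam) g + + lam)
    ≡⟨ sym (∑-cong (sedf-equation-at j)) ⟩
      ∑ (Dᵢ j ⋆ conj (others j))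
    ≡⟨ ∑-⋆ (Dᵢ j) (conj (others j)) ⟩
      ∑ (Dᵢ j) * ∑ (conj (others j))
    ≡⟨ cong₂ _*_ (∑-Dᵢ j) (trans (∑-conj (others j)) (∑-others j)) ⟩
      + k * ((+ m - + 1) * + k)
    ≡⟨ regroup (+ k) (+ m) ⟩
      (+ m - + 1) * (+ k * + k)
    ∎
    where
    open ≡-Reasoning
    expand : ∀ a b → a * (b - + 1) ≡ - a + b * a
    expand = solve-∀
    regroup : ∀ k m → k * ((m - + 1) * k) ≡ (m - + 1) * (k * k)
    regroup = solve-∀
    j : Fin m
    j = fromℕ< (≤-trans (s≤s z≤n) m≥2)

  A : Fin m → ℤ[G]
  A j = Dᵢ j ⋆ conj S

  P : ℤ[G]
  P = S ⋆ conj S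

  Y : Fin m → ℤ[G]
  Y j = ι (+ 2) ⋆ A j ⊖ P

  Q : ℤ[G]
  Q = P ⋆ P ⊕ ι (+ 4) ⋆ L ⋆ P

  A≈norm⊖L : ∀ j → A j ≈ Dᵢ j ⋆ conj (Dᵢ j) ⊖ L
  A≈norm⊖L j = begin
      Dᵢ j ⋆ conj S
    ≈⟨ ⋆-cong ≈-refl (≈-trans (conj-cong (S-split j)) (≗⇒≈ (conj-⊕ (Dᵢ j) (others j)))) ⟩
      Dᵢ j ⋆ (conj (Dᵢ j) ⊕ conj (others j))
    ≈⟨ ≗⇒≈ (⋆-distribˡ (Dᵢ j) (conj (Dᵢ j)) (conj (others j))) ⟩
      Dᵢ j ⋆ conj (Dᵢ j) ⊕ Dᵢ j ⋆ conj (others j)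
    ≈⟨ ⊕-cong ≈-refl (sedf-equation j) ⟩
      Dᵢ j ⋆ conj (Dᵢ j) ⊖ L
    ∎
    where open import Relation.Binary.Reasoning.Setoid (CommutativeRing.setoid quotientRing)

  P-selfConjugate : SelfConjugate P
  P-selfConjugate = norm-selfConjugate S

  L-selfConjugate : SelfConjugate L
  L-selfConjugate = ι-selfConjugate (+ lam)

  A-selfConjugate : ∀ j → SelfConjugate (A j)
  A-selfConjugate j = ≈-trans (conj-cong (A≈norm⊖L j))
    (≈-trans (⊖-selfConjugate (norm-selfConjugate (Dᵢ j)) L-selfConjugate) (≈-sym (A≈norm⊖L j)))

  A-square : ∀ j → A j ⋆ A j ≈ (A j ⊕ L) ⋆ P
  A-square j = begin
      A j ⋆ A j
    ≈⟨ ⋆-cong ≈-refl (≈-sym (A-selfConjugate j)) ⟩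
      A j ⋆ conj (A j)
    ≈⟨ ⋆-cong ≈-refl (≈-trans (≗⇒≈ (conj-⋆ (Dᵢ j) (conj S))) (⋆-cong ≈-refl (≗⇒≈ (conj-involutive S)))) ⟩
      (Dᵢ j ⋆ conj S) ⋆ (conj (Dᵢ j) ⋆ S)
    ≈⟨ solve 4 (λ d s̄ d̄ s → (d :* s̄) :* (d̄ :* s) := (d :* d̄) :* (s :* s̄)) ≈-refl (Dᵢ j) (conj S) (conj (Dᵢ j)) S ⟩
      (Dᵢ j ⋆ conj (Dᵢ j)) ⋆ P
    ≈⟨ ⋆-cong (≈-trans (solve 2 (λ n l → n := n :- l :+ l) ≈-refl (Dᵢ j ⋆ conj (Dᵢ j)) L)
                       (⊕-cong (≈-sym (A≈norm⊖L j)) ≈-refl)) ≈-refl ⟩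
      (A j ⊕ L) ⋆ P
    ∎
    where open import Relation.Binary.Reasoning.Setoid (CommutativeRing.setoid quotientRing)

  Y-square : ∀ j → Y j ⋆ Y j ≈ Q
  Y-square j =
    ≈-trans (expand (A j) P) (≈-trans (⊕-cong (⊕-cong (⋆-cong ≈-refl (A-square j)) ≈-refl) ≈-refl) (collect (A j) L P))
    where
    expand : ∀ a p → (ι (+ 2) ⋆ a ⊖ p) ⋆ (ι (+ 2) ⋆ a ⊖ p) ≈ ι (+ 4) ⋆ (a ⋆ a) ⊖ ι (+ 4) ⋆ a ⋆ p ⊕ p ⋆ p
    expand = solve 2 (λ a p → (con (+ 2) :* a :- p) :* (con (+ 2) :* a :- p)
                              := con (+ 4) :* (a :* a) :- con (+ 4) :* a :* p :+ p :* p) ≈-refl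
    collect : ∀ a l p → ι (+ 4) ⋆ ((a ⊕ l) ⋆ p) ⊖ ι (+ 4) ⋆ a ⋆ p ⊕ p ⋆ p ≈ p ⋆ p ⊕ ι (+ 4) ⋆ l ⋆ p
    collect = solve 3 (λ a l p → con (+ 4) :* ((a :+ l) :* p) :- con (+ 4) :* a :* p :+ p :* p
                                 := p :* p :+ con (+ 4) :* l :* p) ≈-refl

  sum-A : sum A ≈ P
  sum-A = sum-⋆ʳ Dᵢ (conj S)

  sum-Y : sum Y ≈ ι (+ 2 - + m) ⋆ P
  sum-Y = ≈-trans (sum-⊖ (λ j → ι (+ 2) ⋆ A j) P)
    (≈-trans (⊕-cong (≈-trans (sum-⋆ˡ (ι (+ 2)) A) (⋆-cong ≈-refl sum-A)) ≈-refl)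
      (≈-trans (solve 2 (λ p n → con (+ 2) :* p :- n :* p := (con (+ 2) :- n) :* p) ≈-refl P (ι (+ m)))
        (⋆-cong (≈-sym (≈-trans (≗⇒≈ (ι-+ (+ 2) (- + m))) (⊕-cong ≈-refl (≗⇒≈ (ι-neg (+ m)))))) ≈-refl)))

  α : ℤ
  α = + v * + k - + k * + k - (+ v - + 1) * + lam

  τ-A : ∀ j → τ (A j) ≡ α
  τ-A j = begin
      τ (A j)
    ≡⟨ τ-cong (A≈norm⊖L j) ⟩
      τ (Dᵢ j ⋆ conj (Dᵢ j) ⊖ L)
    ≡⟨ trans (τ-⊕ _ _) (cong₂ _+_ (τ-norm (Dᵢ j)) (trans (τ-⊝ L) (cong -_ (τ-ι (+ lam))))) ⟩
      + v * ∑[ g < v ] (Dᵢ j g * Dᵢ j g) - ∑ (Dᵢ j) * ∑ (Dᵢ j) - (+ v - + 1) * + lam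
    ≡⟨ cong₂ (λ a b → + v * a - b * b - (+ v - + 1) * + lam) (trans (∑-cong (𝟙-idempotent (D j))) (∑-Dᵢ j)) (∑-Dᵢ j) ⟩
      α
    ∎
    where open ≡-Reasoning

  τ-P : τ P ≡ + m * α
  τ-P = trans (τ-cong (≈-sym sum-A)) (trans (τ-sum A) (trans (∑-cong τ-A) (∑-const m α)))

  τ-P-centred-nonneg : +0 ≤ τ (P ⋆ P) - + 2 * (+ m * + k) * τ P + (+ v - + 1) * ((+ m * + k) * (+ m * + k))
  τ-P-centred-nonneg = subst (+0 ≤_) (τ-centred-square P (+ m * + k))
    (τ-square-nonneg (⊖-selfConjugate P-selfConjugate (ι-selfConjugate (+ m * + k))))

  infixr 7 L^_⋆_
  L^_⋆_ : ℕ → ℤ[G] → ℤ[G]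
  L^ zero  ⋆ X = X
  L^ suc n ⋆ X = L ⋆ (L^ n ⋆ X)

  τ-L^⋆-pos : ∀ n {X} → +0 < τ X → +0 < τ (L^ n ⋆ X)
  τ-L^⋆-pos zero    p = p
  τ-L^⋆-pos (suc n) p = τ-ι⋆-pos lam≥1 (τ-L^⋆-pos n p)

  τ-L⋆-nonneg : ∀ {X} → +0 ≤ τ X → +0 ≤ τ (L ⋆ X)
  τ-L⋆-nonneg = τ-ι⋆-nonneg lam

  V : ℤ → ℤ → ℤ[G]
  V a b = ι a ⋆ P ⊖ ι b ⋆ L

  V-selfConjugate : ∀ a b → SelfConjugate (V a b)
  V-selfConjugate a b = ⊖-selfConjugate (⋆-selfConjugate (ι-selfConjugate a) P-selfConjugate)
                                         (⋆-selfConjugate (ι-selfConjugate b) L-selfConjugate)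

  τ-P⋆V : ∀ a b → τ (P ⋆ V a b) ≡ a * τ (P ⋆ P) - b * + lam * τ P
  τ-P⋆V a b = begin
      τ (P ⋆ V a b)
    ≡⟨ τ-cong (solve 4 (λ p l a b → p :* (a :* p :- b :* l) := a :* (p :* p) :- b :* (l :* p)) ≈-refl P L (ι a) (ι b)) ⟩
      τ (ι a ⋆ (P ⋆ P) ⊖ ι b ⋆ (L ⋆ P))
    ≡⟨ trans (τ-⊕ _ _) (cong₂ _+_ (τ-ι⋆ a (P ⋆ P)) (trans (τ-⊝ _) (cong -_ (trans (τ-ι⋆ b (L ⋆ P)) (cong (b *_) (τ-ι⋆ (+ lam) P)))))) ⟩
      a * τ (P ⋆ P) - b * (+ lam * τ P)
    ≡⟨ cong (λ x → a * τ (P ⋆ P) - x) (sym (ℤ.*-assoc b (+ lam) (τ P))) ⟩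
      a * τ (P ⋆ P) - b * + lam * τ P
    ∎
    where open ≡-Reasoning

  τ-L⋆P⋆V-pos : ∀ a b → +0 ≤ a → +0 < Φ (+ m) a b (+ k) (+ lam) → +0 < τ (L ⋆ (P ⋆ V a b))
  τ-L⋆P⋆V-pos a b a≥0 Φ>0 = subst (+0 <_) (sym τ-L⋆P⋆V)
    (trace-positivity (+ m) a b lam k (+ v) (τ (P ⋆ P)) a≥0 parameter-relation centred-nonneg Φ>0)
    where
    τ-L⋆P⋆V : τ (L ⋆ (P ⋆ V a b)) ≡ + lam * (a * τ (P ⋆ P) - b * + lam * (+ m * α))
    τ-L⋆P⋆V = trans (τ-ι⋆ (+ lam) (P ⋆ V a b))
      (cong (+ lam *_) (trans (τ-P⋆V a b) (cong (λ x → a * τ (P ⋆ P) - b * + lam * x) τ-P)))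
    centred-nonneg : +0 ≤ τ (P ⋆ P) - + 2 * (+ m * + k) * (+ m * α) + (+ v - + 1) * ((+ m * + k) * (+ m * + k))
    centred-nonneg = subst (λ x → +0 ≤ τ (P ⋆ P) - + 2 * (+ m * + k) * x + (+ v - + 1) * ((+ m * + k) * (+ m * + k)))
      τ-P τ-P-centred-nonneg

  -- τ is positive on the left-hand side of the certificate but vanishes on W.
  no-certificate : ∀ n {Z N W} c c′ c″ → +0 < τ Z →
                   ι (+ suc c) ⋆ (L^ n ⋆ Z) ⊕ N ≈ ι c′ ⋆ W → +0 ≤ τ N →
                   ι (+ suc c″) ⋆ (L ⋆ W) ≈ 0ᴳ → ⊥
  no-certificate n {Z} {N} {W} c c′ c″ τZ>0 certificate τN≥0 W-vanishes = ℤ.<⇒≢ τ>0 (sym τ≡0)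
    where
    τ>0 : +0 < τ (ι (+ suc c) ⋆ (L^ n ⋆ Z) ⊕ N)
    τ>0 = subst (+0 <_) (sym (τ-⊕ _ N)) (ℤ.+-mono-<-≤ (τ-ι⋆-pos (s≤s z≤n) (τ-L^⋆-pos n τZ>0)) τN≥0)
    τW≡0 : τ W ≡ +0
    τW≡0 = a*x≡0⇒x≡0 (τ W) (n≥1⇒+n>0 lam≥1) (a*x≡0⇒x≡0 (+ lam * τ W) (n≥1⇒+n>0 {suc c″} (s≤s z≤n))
      (trans (sym (trans (τ-ι⋆ (+ suc c″) (L ⋆ W)) (cong (+ suc c″ *_) (τ-ι⋆ (+ lam) W)))) (trans (τ-cong W-vanishes) τ-0)))
    τ≡0 : τ (ι (+ suc c) ⋆ (L^ n ⋆ Z) ⊕ N) ≡ +0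
    τ≡0 = trans (τ-cong certificate) (trans (τ-ι⋆ c′ W) (trans (cong (c′ *_) τW≡0) (ℤ.*-zeroʳ c′)))

module FiveBlocks {v : ℕ} (G : FinAbGroup v) {k lam : ℕ} (D : Fin 5 → Subset v) (sedf : IsSEDF G 5 k lam D) where

  open import Data.Nat as ℕ using (z≤n; s≤s)
  open import Data.Integer using (+_; +0; _-_; _≤_; +≤+)
  open import Data.Empty using (⊥)
  open GroupRing G
  open SEDF G D sedf
  open IsSEDF sedf using (lam≥1)
  open Arithmetic using (Φ₅-positive)
  open import Relation.Binary.Reasoning.Setoid (CommutativeRing.setoid quotientRing)

  V₅ : ℤ[G]
  V₅ = V (+ 2) (+ 1)

  W : ℤ[G]
  W = P ⋆ P ⋆ P ⋆ V₅ ⋆ (ι (+ 4) ⋆ P ⊕ ι (+ 25) ⋆ L)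

  W-vanishes : ι (+ 576) ⋆ (L ⋆ W) ≈ 0ᴳ
  W-vanishes = begin
      ι (+ 576) ⋆ (L ⋆ W)
    ≈⟨ solve 2 (λ p l → con (+ 576) :* (l :* (p :* p :* p :* (con (+ 2) :* p :- con (+ 1) :* l) :* (con (+ 4) :* p :+ con (+ 25) :* l)))
                        := Syntax.F 5 (con (+ 2 - + 5) :* p) (p :* p :+ con (+ 4) :* l :* p)) ≈-refl P L ⟩
      F 5 (ι (+ 2 - + 5) ⋆ P) Q
    ≈⟨ F-cong 5 (≈-sym sum-Y) ⟩
      F 5 (sum Y) Q
    ≈⟨ sum-of-square-roots 4 (s≤s (s≤s (s≤s (s≤s (s≤s z≤n))))) Y Y-square ⟩
      0ᴳ
    ∎

  PV : ℤ[G]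
  PV = P ⋆ V₅

  N : ℤ[G]
  N = ι (+ 8) ⋆ (P ⋆ (PV ⋆ PV)) ⊕ ι (+ 54) ⋆ (L ⋆ (PV ⋆ PV)) ⊕ ι (+ 27) ⋆ (L ⋆ (L ⋆ (P ⋆ (V₅ ⋆ V₅))))

  N-nonneg : +0 ≤ τ N
  N-nonneg = τ-⊕-nonneg (τ-⊕-nonneg (τ-ι⋆-nonneg 8 (τ-norm⋆square-nonneg S PV-self))
                                     (τ-ι⋆-nonneg 54 (τ-L⋆-nonneg (τ-square-nonneg PV-self))))
                        (τ-ι⋆-nonneg 27 (τ-L⋆-nonneg (τ-L⋆-nonneg (τ-norm⋆square-nonneg S (V-selfConjugate (+ 2) (+ 1))))))
    where
    PV-self : SelfConjugate PV
    PV-self = ⋆-selfConjugate P-selfConjugate (V-selfConjugate (+ 2) (+ 1))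

  certificate : ι (+ 27) ⋆ (L^ 2 ⋆ (L ⋆ PV)) ⊕ N ≈ ι (+ 4) ⋆ W
  certificate = solve 2 (λ p l → let v = con (+ 2) :* p :- con (+ 1) :* l ; pv = p :* v in
      con (+ 27) :* (l :* (l :* (l :* pv)))
        :+ (con (+ 8) :* (p :* (pv :* pv)) :+ con (+ 54) :* (l :* (pv :* pv)) :+ con (+ 27) :* (l :* (l :* (p :* (v :* v)))))
      := con (+ 4) :* (p :* p :* p :* v :* (con (+ 4) :* p :+ con (+ 25) :* l))) ≈-refl P L

  impossible : 3 ℕ.* lam ℕ.≤ k → ⊥
  impossible 3λ≤k = no-certificate 2 26 (+ 4) 575 (τ-L⋆P⋆V-pos (+ 2) (+ 1) (+≤+ z≤n) (Φ₅-positive lam≥1 3λ≤k))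
                                   certificate N-nonneg W-vanishes

module SixBlocks {v : ℕ} (G : FinAbGroup v) {k lam : ℕ} (D : Fin 6 → Subset v) (sedf : IsSEDF G 6 k lam D) where

  open import Data.Nat as ℕ using (z≤n; s≤s)
  open import Data.Integer using (+_; +0; _-_; _≤_; +≤+)
  open import Data.Empty using (⊥)
  open GroupRing G
  open SEDF G D sedf
  open IsSEDF sedf using (lam≥1)
  open Arithmetic using (Φ₆-positive)
  open import Algebra.Properties.Ring (CommutativeRing.ring quotientRing) using (-0#≈0#)
  open import Relation.Binary.Reasoning.Setoid (CommutativeRing.setoid quotientRing)

  V₆ : ℤ[G]
  V₆ = V (+ 3) (+ 4)

  W : ℤ[G]
  W = P ⋆ P ⋆ P ⋆ P ⋆ V₆ ⋆ (ι (+ 5) ⋆ P ⊕ ι (+ 36) ⋆ L)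

  W-vanishes : ι (+ 4096) ⋆ (L ⋆ W) ≈ 0ᴳ
  W-vanishes = begin
      ι (+ 4096) ⋆ (L ⋆ W)
    ≈⟨ solve 2 (λ p l → con (+ 4096) :* (l :* (p :* p :* p :* p :* (con (+ 3) :* p :- con (+ 4) :* l) :* (con (+ 5) :* p :+ con (+ 36) :* l)))
                        := :- Syntax.F 6 (con (+ 2 - + 6) :* p) (p :* p :+ con (+ 4) :* l :* p)) ≈-refl P L ⟩
      ⊝ (F 6 (ι (+ 2 - + 6) ⋆ P) Q)
    ≈⟨ ⊝-cong (F-cong 6 (≈-sym sum-Y)) ⟩
      ⊝ (F 6 (sum Y) Q)
    ≈⟨ ⊝-cong (sum-of-square-roots 5 (s≤s (s≤s (s≤s (s≤s (s≤s (s≤s z≤n)))))) Y Y-square) ⟩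
      ⊝ 0ᴳ
    ≈⟨ -0#≈0# ⟩
      0ᴳ
    ∎

  PV PPV : ℤ[G]
  PV = P ⋆ V₆
  PPV = P ⋆ PV

  N : ℤ[G]
  N = ι (+ 135) ⋆ (PPV ⋆ PPV) ⊕ ι (+ 1152) ⋆ (L ⋆ (P ⋆ (PV ⋆ PV)))
    ⊕ ι (+ 1536) ⋆ (L ⋆ (L ⋆ (PV ⋆ PV))) ⊕ ι (+ 2048) ⋆ (L ⋆ (L ⋆ (L ⋆ (P ⋆ (V₆ ⋆ V₆)))))

  N-nonneg : +0 ≤ τ N
  N-nonneg = τ-⊕-nonneg (τ-⊕-nonneg (τ-⊕-nonneg (τ-ι⋆-nonneg 135 (τ-square-nonneg PPV-self))
                                                 (τ-ι⋆-nonneg 1152 (τ-L⋆-nonneg (τ-norm⋆square-nonneg S PV-self))))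
                                     (τ-ι⋆-nonneg 1536 (τ-L⋆-nonneg (τ-L⋆-nonneg (τ-square-nonneg PV-self)))))
                        (τ-ι⋆-nonneg 2048 (τ-L⋆-nonneg (τ-L⋆-nonneg (τ-L⋆-nonneg (τ-norm⋆square-nonneg S (V-selfConjugate (+ 3) (+ 4)))))))
    where
    PV-self : SelfConjugate PV
    PV-self = ⋆-selfConjugate P-selfConjugate (V-selfConjugate (+ 3) (+ 4))
    PPV-self : SelfConjugate PPV
    PPV-self = ⋆-selfConjugate P-selfConjugate PV-self

  certificate : ι (+ 8192) ⋆ (L^ 3 ⋆ (L ⋆ PV)) ⊕ N ≈ ι (+ 81) ⋆ W
  certificate = solve 2 (λ p l → let v = con (+ 3) :* p :- con (+ 4) :* l ; pv = p :* v ; ppv = p :* pv in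
      con (+ 8192) :* (l :* (l :* (l :* (l :* pv))))
        :+ (con (+ 135) :* (ppv :* ppv) :+ con (+ 1152) :* (l :* (p :* (pv :* pv)))
            :+ con (+ 1536) :* (l :* (l :* (pv :* pv))) :+ con (+ 2048) :* (l :* (l :* (l :* (p :* (v :* v))))))
      := con (+ 81) :* (p :* p :* p :* p :* v :* (con (+ 5) :* p :+ con (+ 36) :* l))) ≈-refl P L

  impossible : 3 ℕ.* lam ℕ.≤ k → ⊥
  impossible 3λ≤k = no-certificate 3 8191 (+ 81) 4095 (τ-L⋆P⋆V-pos (+ 3) (+ 4) (+≤+ z≤n) (Φ₆-positive lam≥1 3λ≤k))
                                   certificate N-nonneg W-vanishes

open import Data.Nat using (_≤_; _<_)
open import Data.Product using (∃; _×_; _,_)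
open import Relation.Nullary using (¬_)

corollary5p6 : (lam : ℕ) → 1 ≤ lam →
    ∃ λ K → ∀ k → K ≤ k → 1 < k → ∀ v (G : FinAbGroup v) →
      (¬ ∃ λ (D : Fin 5 → Subset v) → IsSEDF G 5 k lam D)
      × (¬ ∃ λ (D : Fin 6 → Subset v) → IsSEDF G 6 k lam D)
corollary5p6 lam _ = 3 Data.Nat.* lam , λ k 3λ≤k _ v G →
  (λ { (D , sedf) → FiveBlocks.impossible G D sedf 3λ≤k }) , (λ { (D , sedf) → SixBlocks.impossible G D sedf 3λ≤k })
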